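{- Let $\Phi$ be a logic program, $A_1,\dots,A_n$ atomic formulas, and $y_1,\dots,y_n$ pairwise distinct term variables not occurring in $A_1,\dots,A_n$. Then $\Phi\vdash\{A_1,\dots,A_n\}\leadsto^*\emptyset$ if and only if $F(\Phi)\vdash\{A_1[y_1],\dots,A_n[y_n]\}\leadsto^*\emptyset$.
   Context: Atomic formulas $P(t_1,\dots,t_n)$ over first-order terms; a logic program is a list of closed Horn formulas $\kappa:\forall\underline{x}.B_1,\dots,B_m\Rightarrow C$ ($m\ge0$) labelled by distinct constants $\kappa$. LP-Unif reduction on multisets of atomic formulas: $\Psi\vdash\{A_1,\dots,A_i,\dots,A_n\}\leadsto\{\gamma A_1,\dots,\gamma B_1,\dots,\gamma B_m,\dots,\gamma A_n\}$ whenever $\kappa:\forall\underline{x}.B_1,\dots,B_m\Rightarrow C\in\Psi$ (quantified variables renamed apart) and $\gamma$ is a most general unifier of $C$ and $A_i$; $\leadsto^*$ is its reflexive–transitive closure. For $A\equiv P(t_1,\dots,t_n)$ and a term $t'$ whose free variables are disjoint from those of the $t_i$, $A[t']$ denotes $P(t_1,\dots,t_n,t')$. The realizability transformation $F(\Phi)$ replaces each axiom $\kappa:\forall\underline{x}.A_1,\dots,A_m\Rightarrow B$ by $\kappa:\forall\underline{x}.\forall\underline{y}.A_1[y_1],\dots,A_m[y_m]\Rightarrow B[f_\kappa(y_1,\dots,y_m)]$, where $y_1,\dots,y_m$ are fresh distinct variables and $f_\kappa$ is a new function symbol of arity $m$ associated with $\kappa$. -}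

module Defs where

open import Data.Nat using (ℕ; zero; suc; _+_; _⊔_)
open import Data.List using (List; []; _∷_; _++_; [_]; map; foldr; zipWith; applyUpTo; length; concatMap)
open import Data.List.Membership.Propositional using (_∈_; _∉_)
open import Data.Sum using (_⊎_; inj₁; inj₂)
open import Data.Product using (Σ; ∃; _×_; _,_)
open import Relation.Binary.PropositionalEquality using (_≡_)
open import Function.Definitions using (Injective)

-- First-order terms over a set Fn of function symbols, variables ℕ.
-- (Symbols are applied to argument lists; unification of f(ts) with
-- f(ss) of different lengths simply fails.)

data Term (Fn : Set) : Set where
  var : ℕ → Term Fn
  fn  : Fn → List (Term Fn) → Term Fn

Subst : Set → Set
Subst Fn = ℕ → Term Fn

module _ {Fn : Set} where
  mutual
    substT : Subst Fn → Term Fn → Term Fn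
    substT σ (var x)   = σ x
    substT σ (fn f ts) = fn f (substTs σ ts)

    substTs : Subst Fn → List (Term Fn) → List (Term Fn)
    substTs σ []       = []
    substTs σ (t ∷ ts) = substT σ t ∷ substTs σ ts

  mutual
    varsT : Term Fn → List ℕ
    varsT (var x)   = x ∷ []
    varsT (fn f ts) = varsTs ts

    varsTs : List (Term Fn) → List ℕ
    varsTs []       = []
    varsTs (t ∷ ts) = varsT t ++ varsTs ts

record Atom (Fn Pr : Set) : Set where
  constructor atom
  field
    pred : Pr
    args : List (Term Fn)
open Atom public

Goal : Set → Set → Set
Goal Fn Pr = List (Atom Fn Pr)   -- a multiset of atoms, presented as a list

module _ {Fn Pr : Set} where
  substA : Subst Fn → Atom Fn Pr → Atom Fn Pr
  substA σ (atom P ts) = atom P (substTs σ ts)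

  substG : Subst Fn → Goal Fn Pr → Goal Fn Pr
  substG σ = map (substA σ)

  varsA : Atom Fn Pr → List ℕ
  varsA (atom P ts) = varsTs ts

  varsG : Goal Fn Pr → List ℕ
  varsG = concatMap varsA

  _⟦_⟧ : Atom Fn Pr → Term Fn → Atom Fn Pr
  atom P ts ⟦ t ⟧ = atom P (ts ++ [ t ])

  Unifier : Subst Fn → Atom Fn Pr → Atom Fn Pr → Set
  Unifier γ A B = substA γ A ≡ substA γ B

  MGU : Subst Fn → Atom Fn Pr → Atom Fn Pr → Set
  MGU γ A B = Unifier γ A B
            × (∀ σ → Unifier σ A B → ∃ λ δ → ∀ x → σ x ≡ substT δ (γ x))

-- A logic program is a list of clauses; the label κ of a clause is its
-- position in the list (so labels are automatically distinct).

record Clause (Fn Pr : Set) : Set where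
  constructor _⇐_
  field
    head : Atom Fn Pr
    body : List (Atom Fn Pr)
open Clause public

Program : Set → Set → Set
Program Fn Pr = List (Clause Fn Pr)

module _ {Fn Pr : Set} where
  varsC : Clause Fn Pr → List ℕ
  varsC (C ⇐ Bs) = varsA C ++ varsG Bs

  renameC : (ℕ → ℕ) → Clause Fn Pr → Clause Fn Pr
  renameC ρ (C ⇐ Bs) = substA σ C ⇐ substG σ Bs
    where σ : Subst Fn
          σ x = var (ρ x)

  data _⊢_⇝_ (Φ : Program Fn Pr) : Goal Fn Pr → Goal Fn Pr → Set where
    step : ∀ {xs A zs} (c : Clause Fn Pr) → c ∈ Φ
         → (ρ : ℕ → ℕ) → Injective _≡_ _≡_ ρ
         → (∀ x → x ∈ varsC (renameC ρ c) → x ∉ varsG (xs ++ A ∷ zs))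
         → (γ : Subst Fn) → MGU γ (head (renameC ρ c)) A
         → Φ ⊢ (xs ++ A ∷ zs) ⇝ substG γ (xs ++ body (renameC ρ c) ++ zs)

  data _⊢_⇝*_ (Φ : Program Fn Pr) : Goal Fn Pr → Goal Fn Pr → Set where
    done : ∀ {G} → Φ ⊢ G ⇝* G
    more : ∀ {G G' G''} → Φ ⊢ G ⇝ G' → Φ ⊢ G' ⇝* G'' → Φ ⊢ G ⇝* G''

-- Realizability transformation.  The new function symbol f_κ for the
-- clause with label (position) κ is  inj₂ κ  in the extended signature
-- Fn ⊎ ℕ; original symbols are embedded via inj₁.

module _ {Fn : Set} where
  mutual
    liftT : Term Fn → Term (Fn ⊎ ℕ)
    liftT (var x)   = var x
    liftT (fn f ts) = fn (inj₁ f) (liftTs ts)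

    liftTs : List (Term Fn) → List (Term (Fn ⊎ ℕ))
    liftTs []       = []
    liftTs (t ∷ ts) = liftT t ∷ liftTs ts

module _ {Fn Pr : Set} where
  liftA : Atom Fn Pr → Atom (Fn ⊎ ℕ) Pr
  liftA (atom P ts) = atom P (liftTs ts)

  maxVarC : Clause Fn Pr → ℕ
  maxVarC c = foldr _⊔_ 0 (varsC c)

  -- κ : ∀x̲.A₁,…,Aₘ ⇒ B   ↦   κ : ∀x̲ y̲. A₁[y₁],…,Aₘ[yₘ] ⇒ B[f_κ(y₁,…,yₘ)]
  -- with y_j = maxVar + 1 + j fresh and distinct.
  realizeClause : ℕ → Clause Fn Pr → Clause (Fn ⊎ ℕ) Pr
  realizeClause κ (B ⇐ As) =
      (liftA B ⟦ fn (inj₂ κ) (map var ys) ⟧)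
    ⇐ zipWith (λ A y → liftA A ⟦ var y ⟧) As ys
    where ys : List ℕ
          ys = applyUpTo (λ j → suc (maxVarC (B ⇐ As)) + j) (length As)

  realizeFrom : ℕ → Program Fn Pr → Program (Fn ⊎ ℕ) Pr
  realizeFrom κ []       = []
  realizeFrom κ (c ∷ Φ)  = realizeClause κ c ∷ realizeFrom (suc κ) Φ

  F : Program Fn Pr → Program (Fn ⊎ ℕ) Pr
  F = realizeFrom 0

-- An F(Φ)-derivation is a Φ-derivation in which every atom carries one extra argument, a witness
-- variable; the invariant (Fresh) is that these witnesses are distinct and occur nowhere else in the goal.
-- Each step is simulated in both directions with the same clause: the mgu of the realized atoms is the
-- lifted mgu of the original ones, extended by sending the witness u of the selected atom to f_κ(ys),
-- and conversely the Fn-part of a realized mgu is an mgu of the original atoms. The new witnesses are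
-- the images under the mgu of the old ones and of ys; they are distinct fresh variables because a
-- unifier that fixes them factors through the mgu. Two points need extra work: MGU over Fn says nothing
-- about substitutions using the f_κ, so most generality over Fn ⊎ ℕ is re-established by rerunning
-- unification; and a Φ-step may rename its clause onto witness variables, so the Φ-derivation is
-- renamed by a permutation of the variables that moves them out of the way.

module Submission where

open import Defs
open import Data.Nat using (ℕ; zero; suc; _+_; _∸_; _⊔_; _≤_; _<_; _≟_; s≤s)
open import Data.Nat.Properties
  using (suc-injective; 0≢1+n; <⇒≢; ≤-refl; ≤-trans; ≤-pred; <-irrefl; <-≤-trans; n≤1+n; m≤m+n; m≤n+m;
         m≤m⊔n; m≤n⊔m; ≰⇒>; +-assoc; +-cancelˡ-≡; _≤?_; m+n∸m≡n; m+n∸n≡m; m∸n+n≡m)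
open import Data.Fin using (Fin; zero; suc)
import Data.Fin.Properties as Fin
open import Data.List using (List; []; _∷_; _++_; [_]; map; length; concatMap; foldr; applyUpTo)
import Data.List as List
open import Data.List.Properties
  using (∷-injective; ∷ʳ-injective; map-++; length-map; length-++; ++-assoc; ++-identityʳ; concatMap-++;
         length-applyUpTo; map-∘; map-cong-local)
open import Data.List.Membership.Propositional using (_∈_; _∉_; find)
open import Data.List.Membership.Propositional.Properties
  using (∈-++⁺ˡ; ∈-++⁺ʳ; ∈-++⁻; ∈-map⁺; ∈-map⁻; ∈-concatMap⁺; ∈-concatMap⁻; ∈-applyUpTo⁻)
open import Data.List.Membership.DecPropositional _≟_ using (_∈?_)
open import Data.List.Relation.Unary.Any as Any using (here; there)
import Data.List.Relation.Unary.All as All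
open import Data.Vec using (Vec; []; _∷_; lookup; toList; zipWith)
open import Data.Vec.Properties using (length-toList)
open import Data.Vec.Membership.Propositional.Properties using (∈-toList⁻)
import Data.Vec.Relation.Unary.Any as VecAny
open import Data.Vec.Relation.Unary.Any.Properties using (lookup-index)
open import Data.Sum as Sum using (_⊎_; inj₁; inj₂; [_,_]′)
open import Data.Product using (Σ; ∃; _×_; _,_; proj₁; proj₂)
open import Data.Empty using (⊥-elim)
open import Relation.Nullary using (Dec; yes; no)
open import Relation.Binary.PropositionalEquality hiding ([_])
open import Function using (_∘_)
open import Function.Definitions using (Injective)
open import Function.Bundles using (_↔_; Inverse; mk↔ₛ′; _⇔_; mk⇔)
open import Function.Construct.Composition using (_↔-∘_)
open import Function.Construct.Identity using (↔-id)

-- Substitutions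

module _ {S : Set} where

  _⊚_ : Subst S → Subst S → Subst S
  (σ ⊚ τ) x = substT σ (τ x)

  mutual
    substT-cong : (σ τ : Subst S) (t : Term S) → (∀ x → x ∈ varsT t → σ x ≡ τ x) → substT σ t ≡ substT τ t
    substT-cong σ τ (var x)   h = h x (here refl)
    substT-cong σ τ (fn f ts) h = cong (fn f) (substTs-cong σ τ ts h)

    substTs-cong : (σ τ : Subst S) (ts : List (Term S)) → (∀ x → x ∈ varsTs ts → σ x ≡ τ x)
      → substTs σ ts ≡ substTs τ ts
    substTs-cong σ τ []       h = refl
    substTs-cong σ τ (t ∷ ts) h =
      cong₂ _∷_ (substT-cong σ τ t (λ x m → h x (∈-++⁺ˡ m))) (substTs-cong σ τ ts (λ x m → h x (∈-++⁺ʳ (varsT t) m)))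

  mutual
    substT-∘ : (σ τ : Subst S) (t : Term S) → substT σ (substT τ t) ≡ substT (σ ⊚ τ) t
    substT-∘ σ τ (var x)   = refl
    substT-∘ σ τ (fn f ts) = cong (fn f) (substTs-∘ σ τ ts)

    substTs-∘ : (σ τ : Subst S) (ts : List (Term S)) → substTs σ (substTs τ ts) ≡ substTs (σ ⊚ τ) ts
    substTs-∘ σ τ []       = refl
    substTs-∘ σ τ (t ∷ ts) = cong₂ _∷_ (substT-∘ σ τ t) (substTs-∘ σ τ ts)

  mutual
    substT-identity : (t : Term S) → substT var t ≡ t
    substT-identity (var x)   = refl
    substT-identity (fn f ts) = cong (fn f) (substTs-identity ts)

    substTs-identity : (ts : List (Term S)) → substTs var ts ≡ ts
    substTs-identity []       = refl
    substTs-identity (t ∷ ts) = cong₂ _∷_ (substT-identity t) (substTs-identity ts)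

  substTs-++ : (σ : Subst S) (ts us : List (Term S)) → substTs σ (ts ++ us) ≡ substTs σ ts ++ substTs σ us
  substTs-++ σ []       us = refl
  substTs-++ σ (t ∷ ts) us = cong (substT σ t ∷_) (substTs-++ σ ts us)

  substTs-map-var : (σ : Subst S) (xs : List ℕ) → substTs σ (map var xs) ≡ map σ xs
  substTs-map-var σ []       = refl
  substTs-map-var σ (x ∷ xs) = cong (σ x ∷_) (substTs-map-var σ xs)

  length-substTs : (σ : Subst S) (ts : List (Term S)) → length (substTs σ ts) ≡ length ts
  length-substTs σ []       = refl
  length-substTs σ (t ∷ ts) = cong suc (length-substTs σ ts)

  varsTs-++ : (ts us : List (Term S)) → varsTs (ts ++ us) ≡ varsTs ts ++ varsTs us
  varsTs-++ []       us = refl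
  varsTs-++ (t ∷ ts) us = trans (cong (varsT t ++_) (varsTs-++ ts us)) (sym (++-assoc (varsT t) (varsTs ts) (varsTs us)))

  varsTs-map-var : (xs : List ℕ) → varsTs {S} (map var xs) ≡ xs
  varsTs-map-var []       = refl
  varsTs-map-var (x ∷ xs) = cong (x ∷_) (varsTs-map-var xs)

  mutual
    ∈-varsT-substT⁻ : (σ : Subst S) (t : Term S) {v : ℕ} → v ∈ varsT (substT σ t) → ∃ λ u
      → u ∈ varsT t × v ∈ varsT (σ u)
    ∈-varsT-substT⁻ σ (var x)   m = x , here refl , m
    ∈-varsT-substT⁻ σ (fn f ts) m = ∈-varsTs-substTs⁻ σ ts m

    ∈-varsTs-substTs⁻ : (σ : Subst S) (ts : List (Term S)) {v : ℕ} → v ∈ varsTs (substTs σ ts) → ∃ λ u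
      → u ∈ varsTs ts × v ∈ varsT (σ u)
    ∈-varsTs-substTs⁻ σ (t ∷ ts) m with ∈-++⁻ (varsT (substT σ t)) m
    ... | inj₁ m₁ = let u , u∈ , v∈ = ∈-varsT-substT⁻ σ t m₁ in u , ∈-++⁺ˡ u∈ , v∈
    ... | inj₂ m₂ = let u , u∈ , v∈ = ∈-varsTs-substTs⁻ σ ts m₂ in u , ∈-++⁺ʳ (varsT t) u∈ , v∈

  mutual
    ∈-varsT-substT⁺ : (σ : Subst S) (t : Term S) {u v : ℕ} → u ∈ varsT t → v ∈ varsT (σ u) → v ∈ varsT (substT σ t)
    ∈-varsT-substT⁺ σ (var x)   (here refl) m = m
    ∈-varsT-substT⁺ σ (fn f ts) u∈          m = ∈-varsTs-substTs⁺ σ ts u∈ m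

    ∈-varsTs-substTs⁺ : (σ : Subst S) (ts : List (Term S)) {u v : ℕ} → u ∈ varsTs ts → v ∈ varsT (σ u)
      → v ∈ varsTs (substTs σ ts)
    ∈-varsTs-substTs⁺ σ (t ∷ ts) u∈ m with ∈-++⁻ (varsT t) u∈
    ... | inj₁ u∈t  = ∈-++⁺ˡ (∈-varsT-substT⁺ σ t u∈t m)
    ... | inj₂ u∈ts = ∈-++⁺ʳ (varsT (substT σ t)) (∈-varsTs-substTs⁺ σ ts u∈ts m)

  var-injective : {x y : ℕ} → var {S} x ≡ var y → x ≡ y
  var-injective refl = refl

  fn-injective : {f g : S} {ts us : List (Term S)} → fn f ts ≡ fn g us → f ≡ g × ts ≡ us
  fn-injective refl = refl , refl

  rename : (ℕ → ℕ) → Subst S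
  rename ρ x = var (ρ x)

  varOf : Term S → ℕ
  varOf (var x)   = x
  varOf (fn f ts) = 0

atom-injective : {S Pr : Set} {P Q : Pr} {ts us : List (Term S)} → atom P ts ≡ atom Q us → P ≡ Q × ts ≡ us
atom-injective refl = refl , refl

module _ {S Pr : Set} where

  substA-cong : (σ τ : Subst S) (A : Atom S Pr) → (∀ x → x ∈ varsA A → σ x ≡ τ x) → substA σ A ≡ substA τ A
  substA-cong σ τ (atom P ts) h = cong (atom P) (substTs-cong σ τ ts h)

  substA-∘ : (σ τ : Subst S) (A : Atom S Pr) → substA σ (substA τ A) ≡ substA (σ ⊚ τ) A
  substA-∘ σ τ (atom P ts) = cong (atom P) (substTs-∘ σ τ ts)

  substG-cong : (σ τ : Subst S) (G : Goal S Pr) → (∀ x → x ∈ varsG G → σ x ≡ τ x) → substG σ G ≡ substG τ G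
  substG-cong σ τ []      h = refl
  substG-cong σ τ (A ∷ G) h =
    cong₂ _∷_ (substA-cong σ τ A (λ x m → h x (∈-++⁺ˡ m))) (substG-cong σ τ G (λ x m → h x (∈-++⁺ʳ (varsA A) m)))

  substG-∘ : (σ τ : Subst S) (G : Goal S Pr) → substG σ (substG τ G) ≡ substG (σ ⊚ τ) G
  substG-∘ σ τ []      = refl
  substG-∘ σ τ (A ∷ G) = cong₂ _∷_ (substA-∘ σ τ A) (substG-∘ σ τ G)

  substG-identity : (G : Goal S Pr) → substG var G ≡ G
  substG-identity []               = refl
  substG-identity (atom P ts ∷ G) = cong₂ _∷_ (cong (atom P) (substTs-identity ts)) (substG-identity G)

  substG-++ : (σ : Subst S) (G H : Goal S Pr) → substG σ (G ++ H) ≡ substG σ G ++ substG σ H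
  substG-++ σ = map-++ (substA σ)

  varsG-++ : (G H : Goal S Pr) → varsG (G ++ H) ≡ varsG G ++ varsG H
  varsG-++ = concatMap-++ varsA

  substA-⟦⟧ : (σ : Subst S) (A : Atom S Pr) (t : Term S) → substA σ (A ⟦ t ⟧) ≡ substA σ A ⟦ substT σ t ⟧
  substA-⟦⟧ σ (atom P ts) t = cong (atom P) (substTs-++ σ ts [ t ])

  varsA-⟦⟧ : (A : Atom S Pr) (t : Term S) → varsA (A ⟦ t ⟧) ≡ varsA A ++ varsT t
  varsA-⟦⟧ (atom P ts) t = trans (varsTs-++ ts [ t ]) (cong (varsTs ts ++_) (++-identityʳ (varsT t)))

  ⟦⟧-unifier⁻ : (σ : Subst S) {P Q : Pr} (ts us : List (Term S)) (t u : Term S)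
    → Unifier σ (atom P ts ⟦ t ⟧) (atom Q us ⟦ u ⟧) → P ≡ Q × substTs σ ts ≡ substTs σ us × substT σ t ≡ substT σ u
  ⟦⟧-unifier⁻ σ ts us t u e =
    let P≡Q , args≡ = atom-injective e
        init≡ , last≡ = ∷ʳ-injective (substTs σ ts) (substTs σ us)
                          (trans (sym (substTs-++ σ ts [ t ])) (trans args≡ (substTs-++ σ us [ u ])))
    in P≡Q , init≡ , last≡

  ⟦⟧-unifier⁺ : (σ : Subst S) {P Q : Pr} (ts us : List (Term S)) (t u : Term S)
    → P ≡ Q → substTs σ ts ≡ substTs σ us → substT σ t ≡ substT σ u → Unifier σ (atom P ts ⟦ t ⟧) (atom Q us ⟦ u ⟧)
  ⟦⟧-unifier⁺ σ ts us t u P≡Q init≡ last≡ =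
    cong₂ atom P≡Q (trans (substTs-++ σ ts [ t ]) (trans (cong₂ _++_ init≡ (cong [_] last≡)) (sym (substTs-++ σ us [ u ]))))

  ∈-varsA-substA⁻ : (σ : Subst S) (A : Atom S Pr) {v : ℕ} → v ∈ varsA (substA σ A) → ∃ λ u
    → u ∈ varsA A × v ∈ varsT (σ u)
  ∈-varsA-substA⁻ σ (atom P ts) = ∈-varsTs-substTs⁻ σ ts

  ∈-varsA-substA⁺ : (σ : Subst S) (A : Atom S Pr) {u v : ℕ} → u ∈ varsA A → v ∈ varsT (σ u) → v ∈ varsA (substA σ A)
  ∈-varsA-substA⁺ σ (atom P ts) = ∈-varsTs-substTs⁺ σ ts

  ∈-varsG-substG⁻ : (σ : Subst S) (G : Goal S Pr) {v : ℕ} → v ∈ varsG (substG σ G) → ∃ λ u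
    → u ∈ varsG G × v ∈ varsT (σ u)
  ∈-varsG-substG⁻ σ (A ∷ G) m with ∈-++⁻ (varsA (substA σ A)) m
  ... | inj₁ m₁ = let u , u∈ , v∈ = ∈-varsA-substA⁻ σ A m₁ in u , ∈-++⁺ˡ u∈ , v∈
  ... | inj₂ m₂ = let u , u∈ , v∈ = ∈-varsG-substG⁻ σ G m₂ in u , ∈-++⁺ʳ (varsA A) u∈ , v∈

  ∈-varsG-substG⁺ : (σ : Subst S) (G : Goal S Pr) {u v : ℕ} → u ∈ varsG G → v ∈ varsT (σ u) → v ∈ varsG (substG σ G)
  ∈-varsG-substG⁺ σ (A ∷ G) u∈ m with ∈-++⁻ (varsA A) u∈
  ... | inj₁ u∈A = ∈-++⁺ˡ (∈-varsA-substA⁺ σ A u∈A m)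
  ... | inj₂ u∈G = ∈-++⁺ʳ (varsA (substA σ A)) (∈-varsG-substG⁺ σ G u∈G m)

  ∈-varsC-rename⁻ : (ρ : ℕ → ℕ) (c : Clause S Pr) {v : ℕ} → v ∈ varsC (renameC ρ c) → ∃ λ u → u ∈ varsC c × v ≡ ρ u
  ∈-varsC-rename⁻ ρ (C ⇐ Bs) m with ∈-++⁻ (varsA (substA (rename ρ) C)) m
  ... | inj₁ m₁ with ∈-varsA-substA⁻ (rename ρ) C m₁
  ...   | u , u∈ , here refl = u , ∈-++⁺ˡ u∈ , refl
  ∈-varsC-rename⁻ ρ (C ⇐ Bs) m | inj₂ m₂ with ∈-varsG-substG⁻ (rename ρ) Bs m₂
  ...   | u , u∈ , here refl = u , ∈-++⁺ʳ (varsA C) u∈ , refl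

  ∈-varsC-rename⁺ : (ρ : ℕ → ℕ) (c : Clause S Pr) {u : ℕ} → u ∈ varsC c → ρ u ∈ varsC (renameC ρ c)
  ∈-varsC-rename⁺ ρ (C ⇐ Bs) u∈ with ∈-++⁻ (varsA C) u∈
  ... | inj₁ u∈C  = ∈-++⁺ˡ (∈-varsA-substA⁺ (rename ρ) C u∈C (here refl))
  ... | inj₂ u∈Bs = ∈-++⁺ʳ (varsA (substA (rename ρ) C)) (∈-varsG-substG⁺ (rename ρ) Bs u∈Bs (here refl))

  renameC-cong : (ρ ρ′ : ℕ → ℕ) (C : Atom S Pr) (Bs : Goal S Pr) → (∀ {x} → x ∈ varsC (C ⇐ Bs) → ρ x ≡ ρ′ x)
    → substA (rename ρ) C ≡ substA (rename ρ′) C × substG (rename ρ) Bs ≡ substG (rename ρ′) Bs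
  renameC-cong ρ ρ′ C Bs agree =
    substA-cong (rename ρ) (rename ρ′) C (λ x x∈ → cong var (agree (∈-++⁺ˡ x∈))) ,
    substG-cong (rename ρ) (rename ρ′) Bs (λ x x∈ → cong var (agree (∈-++⁺ʳ (varsA C) x∈)))

module _ {S Pr : Set} where

  ∈-varsG-++⁻ : (G H : Goal S Pr) {x : ℕ} → x ∈ varsG (G ++ H) → x ∈ varsG G ⊎ x ∈ varsG H
  ∈-varsG-++⁻ G H = ∈-++⁻ (varsG G) ∘ subst (_ ∈_) (varsG-++ G H)

  ∈-varsG-++⁺ˡ : (G H : Goal S Pr) {x : ℕ} → x ∈ varsG G → x ∈ varsG (G ++ H)
  ∈-varsG-++⁺ˡ G H = subst (_ ∈_) (sym (varsG-++ G H)) ∘ ∈-++⁺ˡ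

  ∈-varsG-++⁺ʳ : (G H : Goal S Pr) {x : ℕ} → x ∈ varsG H → x ∈ varsG (G ++ H)
  ∈-varsG-++⁺ʳ G H = subst (_ ∈_) (sym (varsG-++ G H)) ∘ ∈-++⁺ʳ (varsG G)

++-injective-length : {A : Set} (xs ys : List A) {zs ws : List A} → length xs ≡ length ys
  → xs ++ zs ≡ ys ++ ws → xs ≡ ys × zs ≡ ws
++-injective-length []       []       l e = refl , e
++-injective-length (x ∷ xs) (y ∷ ys) l e =
  let x≡y , e′ = ∷-injective e
      xs≡ys , zs≡ws = ++-injective-length xs ys (suc-injective l) e′
  in cong₂ _∷_ x≡y xs≡ys , zs≡ws

length-++-∷⁻ : {A B : Set} (xs : List A) {y : A} {zs : List A} (ws : List B) → length ws ≡ length (xs ++ y ∷ zs)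
  → ∃ λ ws₁ → ∃ λ u → ∃ λ ws₂ → ws ≡ ws₁ ++ u ∷ ws₂ × length ws₁ ≡ length xs × length ws₂ ≡ length zs
length-++-∷⁻ []       (u ∷ ws) l = [] , u , ws , refl , refl , suc-injective l
length-++-∷⁻ (x ∷ xs) (w ∷ ws) l =
  let ws₁ , u , ws₂ , ws≡ , l₁ , l₂ = length-++-∷⁻ xs ws (suc-injective l)
  in w ∷ ws₁ , u , ws₂ , cong (w ∷_) ws≡ , cong suc l₁ , l₂

data Distinct : List ℕ → Set where
  []  : Distinct []
  _∷_ : ∀ {w ws} → w ∉ ws → Distinct ws → Distinct (w ∷ ws)

Distinct-++⁺ : (xs : List ℕ) {ys : List ℕ} → Distinct xs → Distinct ys → (∀ {x} → x ∈ xs → x ∉ ys) → Distinct (xs ++ ys)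
Distinct-++⁺ []       []           dys apart = dys
Distinct-++⁺ (x ∷ xs) (x∉ ∷ dxs) dys apart =
  [ x∉ , apart (here refl) ]′ ∘ ∈-++⁻ xs ∷ Distinct-++⁺ xs dxs dys (apart ∘ there)

Distinct-++⁻ : (xs : List ℕ) {ys : List ℕ} → Distinct (xs ++ ys) → Distinct xs × Distinct ys × (∀ {x} → x ∈ xs → x ∉ ys)
Distinct-++⁻ []       d          = [] , d , λ ()
Distinct-++⁻ (x ∷ xs) (x∉ ∷ d) =
  let dxs , dys , apart = Distinct-++⁻ xs d
  in (x∉ ∘ ∈-++⁺ˡ) ∷ dxs , dys , λ { (here refl) → x∉ ∘ ∈-++⁺ʳ xs ; (there x∈) → apart x∈ }

Distinct-map : (f : ℕ → ℕ) {xs : List ℕ} → Distinct xs → (∀ {a b} → a ∈ xs → b ∈ xs → f a ≡ f b → a ≡ b)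
  → Distinct (map f xs)
Distinct-map f []         inj = []
Distinct-map f (x∉ ∷ dxs) inj =
  (λ fx∈ → let y , y∈ , fx≡fy = ∈-map⁻ f fx∈ in x∉ (subst (_∈ _) (sym (inj (here refl) (there y∈) fx≡fy)) y∈))
  ∷ Distinct-map f dxs (λ a∈ b∈ → inj (there a∈) (there b∈))

Distinct-applyUpTo : (f : ℕ → ℕ) (n : ℕ) → (∀ {i j} → f i ≡ f j → i ≡ j) → Distinct (applyUpTo f n)
Distinct-applyUpTo f zero    inj = []
Distinct-applyUpTo f (suc n) inj =
  (λ f0∈ → let j , _ , f0≡fsj = ∈-applyUpTo⁻ (f ∘ suc) f0∈ in 0≢1+n (inj f0≡fsj))
  ∷ Distinct-applyUpTo (f ∘ suc) n (suc-injective ∘ inj)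

bound : List ℕ → ℕ
bound xs = suc (foldr _⊔_ 0 xs)

∈⇒<bound : {x : ℕ} (xs : List ℕ) → x ∈ xs → x < bound xs
∈⇒<bound (y ∷ xs) (here refl) = s≤s (m≤m⊔n y _)
∈⇒<bound (y ∷ xs) (there x∈)  = ≤-trans (∈⇒<bound xs x∈) (s≤s (m≤n⊔m y _))

patchAbove : List ℕ → (ℕ → ℕ) → ℕ → ℕ → ℕ
patchAbove V ρ M z with z ∈? V
... | yes _ = ρ z
... | no _  = M + z

patchAbove-∈ : (V : List ℕ) (ρ : ℕ → ℕ) (M : ℕ) {z : ℕ} → z ∈ V → patchAbove V ρ M z ≡ ρ z
patchAbove-∈ V ρ M {z} z∈ with z ∈? V
... | yes _  = refl
... | no z∉ = ⊥-elim (z∉ z∈)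

patchAbove-∉ : (V : List ℕ) (ρ : ℕ → ℕ) (M : ℕ) {z : ℕ} → z ∉ V → patchAbove V ρ M z ≡ M + z
patchAbove-∉ V ρ M {z} z∉ with z ∈? V
... | yes z∈ = ⊥-elim (z∉ z∈)
... | no _   = refl

patchAbove-injective : (V : List ℕ) (ρ : ℕ → ℕ) (M : ℕ) → Injective _≡_ _≡_ ρ → (∀ {z} → z ∈ V → ρ z < M)
  → Injective _≡_ _≡_ (patchAbove V ρ M)
patchAbove-injective V ρ M ρ-inj ρ<M {x} {y} e with x ∈? V | y ∈? V
... | yes x∈ | yes y∈ = ρ-inj e
... | no _   | no _   = +-cancelˡ-≡ M x y e
... | yes x∈ | no _   = ⊥-elim (<⇒≢ (<-≤-trans (ρ<M x∈) (m≤m+n M y)) e)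
... | no _   | yes y∈ = ⊥-elim (<⇒≢ (<-≤-trans (ρ<M y∈) (m≤m+n M x)) (sym e))

-- The extended signature

module _ {Fn : Set} where

  liftSubst : Subst Fn → Subst (Fn ⊎ ℕ)
  liftSubst σ x = liftT (σ x)

  mutual
    liftT-substT : (σ : Subst Fn) (t : Term Fn) → liftT (substT σ t) ≡ substT (liftSubst σ) (liftT t)
    liftT-substT σ (var x)   = refl
    liftT-substT σ (fn f ts) = cong (fn (inj₁ f)) (liftTs-substTs σ ts)

    liftTs-substTs : (σ : Subst Fn) (ts : List (Term Fn)) → liftTs (substTs σ ts) ≡ substTs (liftSubst σ) (liftTs ts)
    liftTs-substTs σ []       = refl
    liftTs-substTs σ (t ∷ ts) = cong₂ _∷_ (liftT-substT σ t) (liftTs-substTs σ ts)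

  mutual
    varsT-liftT : (t : Term Fn) → varsT (liftT t) ≡ varsT t
    varsT-liftT (var x)   = refl
    varsT-liftT (fn f ts) = varsTs-liftTs ts

    varsTs-liftTs : (ts : List (Term Fn)) → varsTs (liftTs ts) ≡ varsTs ts
    varsTs-liftTs []       = refl
    varsTs-liftTs (t ∷ ts) = cong₂ _++_ (varsT-liftT t) (varsTs-liftTs ts)

  -- The new symbols f_κ have no preimage under liftT; lowerT sends them to the junk value var 0.
  mutual
    lowerT : Term (Fn ⊎ ℕ) → Term Fn
    lowerT (var x)          = var x
    lowerT (fn (inj₁ f) ts) = fn f (lowerTs ts)
    lowerT (fn (inj₂ κ) ts) = var 0

    lowerTs : List (Term (Fn ⊎ ℕ)) → List (Term Fn)
    lowerTs []       = []
    lowerTs (t ∷ ts) = lowerT t ∷ lowerTs ts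

  mutual
    lowerT-liftT : (t : Term Fn) → lowerT (liftT t) ≡ t
    lowerT-liftT (var x)   = refl
    lowerT-liftT (fn f ts) = cong (fn f) (lowerTs-liftTs ts)

    lowerTs-liftTs : (ts : List (Term Fn)) → lowerTs (liftTs ts) ≡ ts
    lowerTs-liftTs []       = refl
    lowerTs-liftTs (t ∷ ts) = cong₂ _∷_ (lowerT-liftT t) (lowerTs-liftTs ts)

  mutual
    lowerT-substT-liftT : (σ : Subst (Fn ⊎ ℕ)) (t : Term Fn) → lowerT (substT σ (liftT t)) ≡ substT (lowerT ∘ σ) t
    lowerT-substT-liftT σ (var x)   = refl
    lowerT-substT-liftT σ (fn f ts) = cong (fn f) (lowerTs-substTs-liftTs σ ts)

    lowerTs-substTs-liftTs : (σ : Subst (Fn ⊎ ℕ)) (ts : List (Term Fn))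
      → lowerTs (substTs σ (liftTs ts)) ≡ substTs (lowerT ∘ σ) ts
    lowerTs-substTs-liftTs σ []       = refl
    lowerTs-substTs-liftTs σ (t ∷ ts) = cong₂ _∷_ (lowerT-substT-liftT σ t) (lowerTs-substTs-liftTs σ ts)

  mutual
    substT≡liftT⇒lifted : (δ : Subst (Fn ⊎ ℕ)) (t : Term (Fn ⊎ ℕ)) (s : Term Fn) → substT δ t ≡ liftT s
      → t ≡ liftT (lowerT t)
    substT≡liftT⇒lifted δ (var x)          s         e = refl
    substT≡liftT⇒lifted δ (fn (inj₁ f) ts) (fn g us) e =
      cong (fn (inj₁ f)) (substTs≡liftTs⇒lifted δ ts us (proj₂ (fn-injective e)))
    substT≡liftT⇒lifted δ (fn (inj₂ κ) ts) (fn g us) e with () ← proj₁ (fn-injective e)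

    substTs≡liftTs⇒lifted : (δ : Subst (Fn ⊎ ℕ)) (ts : List (Term (Fn ⊎ ℕ))) (us : List (Term Fn))
      → substTs δ ts ≡ liftTs us → ts ≡ liftTs (lowerTs ts)
    substTs≡liftTs⇒lifted δ []       []       e = refl
    substTs≡liftTs⇒lifted δ (t ∷ ts) (u ∷ us) e =
      cong₂ _∷_ (substT≡liftT⇒lifted δ t u (proj₁ (∷-injective e))) (substTs≡liftTs⇒lifted δ ts us (proj₂ (∷-injective e)))

module _ {Fn Pr : Set} where

  liftA-substA : (σ : Subst Fn) (A : Atom Fn Pr) → liftA (substA σ A) ≡ substA (liftSubst σ) (liftA A)
  liftA-substA σ (atom P ts) = cong (atom P) (liftTs-substTs σ ts)

  varsA-liftA : (A : Atom Fn Pr) → varsA (liftA A) ≡ varsA A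
  varsA-liftA (atom P ts) = varsTs-liftTs ts

  unifier-liftA : (σ : Subst Fn) (A B : Atom Fn Pr) → Unifier σ A B → Unifier (liftSubst σ) (liftA A) (liftA B)
  unifier-liftA σ A B unifies = trans (sym (liftA-substA σ A)) (trans (cong liftA unifies) (liftA-substA σ B))

-- Unification guided by a known unifier

module _ {S : Set} where

  mutual
    sizeT : Term S → ℕ
    sizeT (var x)   = 1
    sizeT (fn f ts) = suc (sizeTs ts)

    sizeTs : List (Term S) → ℕ
    sizeTs []       = 0
    sizeTs (t ∷ ts) = sizeT t + sizeTs ts

  sizeTs-++ : (ts us : List (Term S)) → sizeTs (ts ++ us) ≡ sizeTs ts + sizeTs us
  sizeTs-++ []       us = refl
  sizeTs-++ (t ∷ ts) us = trans (cong (sizeT t +_) (sizeTs-++ ts us)) (sym (+-assoc (sizeT t) (sizeTs ts) (sizeTs us)))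

  n<sizeT+n : (t : Term S) (n : ℕ) → n < sizeT t + n
  n<sizeT+n (var x)   n = ≤-refl
  n<sizeT+n (fn f ts) n = s≤s (m≤n+m n (sizeTs ts))

  mutual
    sizeT-var≤ : (θ : Subst S) (t : Term S) {x : ℕ} → x ∈ varsT t → sizeT (θ x) ≤ sizeT (substT θ t)
    sizeT-var≤ θ (var y)   (here refl) = ≤-refl
    sizeT-var≤ θ (fn f ts) x∈          = ≤-trans (sizeTs-var≤ θ ts x∈) (n≤1+n _)

    sizeTs-var≤ : (θ : Subst S) (ts : List (Term S)) {x : ℕ} → x ∈ varsTs ts → sizeT (θ x) ≤ sizeTs (substTs θ ts)
    sizeTs-var≤ θ (t ∷ ts) x∈ with ∈-++⁻ (varsT t) x∈
    ... | inj₁ x∈t  = ≤-trans (sizeT-var≤ θ t x∈t) (m≤m+n _ _)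
    ... | inj₂ x∈ts = ≤-trans (sizeTs-var≤ θ ts x∈ts) (m≤n+m _ _)

  occurs-check : (θ : Subst S) {x : ℕ} (f : S) (ts : List (Term S)) → θ x ≡ substT θ (fn f ts) → x ∉ varsTs ts
  occurs-check θ f ts e x∈ = <-irrefl refl (subst (λ t → sizeT t ≤ sizeTs (substTs θ ts)) e (sizeTs-var≤ θ ts x∈))

  bind : ℕ → Term S → Subst S
  bind x t z with z ≟ x
  ... | yes _ = t
  ... | no _  = var z

  bind-≡ : (x : ℕ) (t : Term S) → bind x t x ≡ t
  bind-≡ x t with x ≟ x
  ... | yes _  = refl
  ... | no x≢x = ⊥-elim (x≢x refl)

  bind-≢ : (x : ℕ) (t : Term S) {z : ℕ} → z ≢ x → bind x t z ≡ var z
  bind-≢ x t {z} z≢x with z ≟ x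
  ... | yes z≡x = ⊥-elim (z≢x z≡x)
  ... | no _    = refl

  substT-bind-fresh : (x : ℕ) (t s : Term S) → x ∉ varsT s → substT (bind x t) s ≡ s
  substT-bind-fresh x t s x∉ =
    trans (substT-cong (bind x t) var s (λ z z∈ → bind-≢ x t (λ { refl → x∉ z∈ }))) (substT-identity s)

  ⊚-bind : (θ : Subst S) (x : ℕ) (t : Term S) → θ x ≡ substT θ t → ∀ z → (θ ⊚ bind x t) z ≡ θ z
  ⊚-bind θ x t e z with z ≟ x
  ... | yes refl = sym e
  ... | no _     = refl

module _ {Fn : Set} where

  liftTs-++ : (ts us : List (Term Fn)) → liftTs (ts ++ us) ≡ liftTs ts ++ liftTs us
  liftTs-++ []       us = refl
  liftTs-++ (t ∷ ts) us = cong (liftT t ∷_) (liftTs-++ ts us)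

  substTs-liftTs-++ : (σ : Subst (Fn ⊎ ℕ)) (ts us : List (Term Fn))
    → substTs σ (liftTs (ts ++ us)) ≡ substTs σ (liftTs ts) ++ substTs σ (liftTs us)
  substTs-liftTs-++ σ ts us = trans (cong (substTs σ) (liftTs-++ ts us)) (substTs-++ σ (liftTs ts) (liftTs us))

  substT-liftT-∘ : (σ : Subst (Fn ⊎ ℕ)) (ρ : Subst Fn) (t : Term Fn)
    → substT σ (liftT (substT ρ t)) ≡ substT (σ ⊚ liftSubst ρ) (liftT t)
  substT-liftT-∘ σ ρ t = trans (cong (substT σ) (liftT-substT ρ t)) (substT-∘ σ (liftSubst ρ) (liftT t))

  substTs-liftTs-∘ : (σ : Subst (Fn ⊎ ℕ)) (ρ : Subst Fn) (ts : List (Term Fn))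
    → substTs σ (liftTs (substTs ρ ts)) ≡ substTs (σ ⊚ liftSubst ρ) (liftTs ts)
  substTs-liftTs-∘ σ ρ ts = trans (cong (substTs σ) (liftTs-substTs ρ ts)) (substTs-∘ σ (liftSubst ρ) (liftTs ts))

  -- MGU only quantifies over substitutions of Fn, whereas F Φ needs most generality among substitutions
  -- that use the symbols f_κ; it is recovered by rerunning unification in Fn.
  LiftedMostGeneral : Subst Fn → List (Term Fn) → List (Term Fn) → Set
  LiftedMostGeneral μ ts us =
    ∀ (σ : Subst (Fn ⊎ ℕ)) → substTs σ (liftTs ts) ≡ substTs σ (liftTs us)
    → ∃ λ δ → ∀ x → σ x ≡ substT δ (liftT (μ x))

  Solution : List (Term Fn) → List (Term Fn) → Set
  Solution ts us = Σ (Subst Fn) λ μ → substTs μ ts ≡ substTs μ us × LiftedMostGeneral μ ts us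

  solution-sym : {ts us : List (Term Fn)} → Solution ts us → Solution us ts
  solution-sym (μ , unifies , general) = μ , sym unifies , λ σ e → general σ (sym e)

  solution-skip : (x : ℕ) {ts us : List (Term Fn)} → Solution ts us → Solution (var x ∷ ts) (var x ∷ us)
  solution-skip x (μ , unifies , general) = μ , cong (μ x ∷_) unifies , λ σ e → general σ (proj₂ (∷-injective e))

  solution-decompose : (f : Fn) (ts′ us′ ts us : List (Term Fn)) → length ts′ ≡ length us′
    → Solution (ts′ ++ ts) (us′ ++ us) → Solution (fn f ts′ ∷ ts) (fn f us′ ∷ us)
  solution-decompose f ts′ us′ ts us l (μ , unifies , general) =
    μ , cong₂ _∷_ (cong (fn f) args≡) rest≡ , general′
    where
      split : substTs μ ts′ ≡ substTs μ us′ × substTs μ ts ≡ substTs μ us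
      split = ++-injective-length (substTs μ ts′) (substTs μ us′)
                (trans (length-substTs μ ts′) (trans l (sym (length-substTs μ us′))))
                (trans (sym (substTs-++ μ ts′ ts)) (trans unifies (substTs-++ μ us′ us)))
      args≡ : substTs μ ts′ ≡ substTs μ us′
      args≡ = proj₁ split
      rest≡ : substTs μ ts ≡ substTs μ us
      rest≡ = proj₂ split
      general′ : LiftedMostGeneral μ (fn f ts′ ∷ ts) (fn f us′ ∷ us)
      general′ σ e =
        let head≡ , rest≡′ = ∷-injective e
        in general σ (trans (substTs-liftTs-++ σ ts′ ts)
                     (trans (cong₂ _++_ (proj₂ (fn-injective head≡)) rest≡′) (sym (substTs-liftTs-++ σ us′ us))))

  bind-liftT : (σ : Subst (Fn ⊎ ℕ)) (x : ℕ) (t : Term Fn) → σ x ≡ substT σ (liftT t) → ∀ z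
    → σ z ≡ substT σ (liftT (bind x t z))
  bind-liftT σ x t e z with z ≟ x
  ... | yes refl = e
  ... | no _     = refl

  solution-eliminate : (x : ℕ) (t : Term Fn) (ts us : List (Term Fn)) → x ∉ varsT t
    → Solution (substTs (bind x t) ts) (substTs (bind x t) us) → Solution (var x ∷ ts) (t ∷ us)
  solution-eliminate x t ts us x∉t (μ′ , unifies , general) = μ , cong₂ _∷_ head≡ rest≡ , general′
    where
      b μ : Subst Fn
      b = bind x t
      μ = μ′ ⊚ b
      head≡ : μ x ≡ substT μ t
      head≡ = begin
        substT μ′ (b x)          ≡⟨ cong (substT μ′) (bind-≡ x t) ⟩
        substT μ′ t              ≡⟨ cong (substT μ′) (sym (substT-bind-fresh x t t x∉t)) ⟩
        substT μ′ (substT b t)   ≡⟨ substT-∘ μ′ b t ⟩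
        substT μ t               ∎
        where open ≡-Reasoning
      rest≡ : substTs μ ts ≡ substTs μ us
      rest≡ = trans (sym (substTs-∘ μ′ b ts)) (trans unifies (substTs-∘ μ′ b us))
      general′ : LiftedMostGeneral μ (var x ∷ ts) (t ∷ us)
      general′ σ e = δ , factor
        where
          pw : ∀ z → σ z ≡ substT σ (liftT (b z))
          pw = bind-liftT σ x t (proj₁ (∷-injective e))
          lifted-b : (vs : List (Term Fn)) → substTs σ (liftTs (substTs b vs)) ≡ substTs σ (liftTs vs)
          lifted-b vs = trans (substTs-liftTs-∘ σ b vs) (sym (substTs-cong σ _ (liftTs vs) (λ z _ → pw z)))
          δ-spec : ∃ λ δ → ∀ z → σ z ≡ substT δ (liftT (μ′ z))
          δ-spec = general σ (trans (lifted-b ts) (trans (proj₂ (∷-injective e)) (sym (lifted-b us))))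
          δ : Subst (Fn ⊎ ℕ)
          δ = proj₁ δ-spec
          factor : ∀ z → σ z ≡ substT δ (liftT (μ z))
          factor z = begin
            σ z                                              ≡⟨ pw z ⟩
            substT σ (liftT (b z))                           ≡⟨ substT-cong σ _ (liftT (b z)) (λ v _ → proj₂ δ-spec v) ⟩
            substT (δ ⊚ liftSubst μ′) (liftT (b z))          ≡⟨ sym (substT-liftT-∘ δ μ′ (b z)) ⟩
            substT δ (liftT (μ z))                           ∎
            where open ≡-Reasoning

  substTs-bind-invisible : (θ : Subst Fn) (x : ℕ) (t : Term Fn) → θ x ≡ substT θ t
    → (vs : List (Term Fn)) → substTs θ (substTs (bind x t) vs) ≡ substTs θ vs
  substTs-bind-invisible θ x t e vs = trans (substTs-∘ θ (bind x t) vs) (substTs-cong _ θ vs (λ z _ → ⊚-bind θ x t e z))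

  eliminated-bound : (θ : Subst Fn) (x : ℕ) (t : Term Fn) (ts : List (Term Fn)) {n : ℕ} → θ x ≡ substT θ t
    → sizeTs (substTs θ (var x ∷ ts)) < suc n → sizeTs (substTs θ (substTs (bind x t) ts)) < n
  eliminated-bound θ x t ts e size< =
    subst (_< _) (sym (cong sizeTs (substTs-bind-invisible θ x t e ts))) (<-≤-trans (n<sizeT+n (θ x) _) (≤-pred size<))

  eliminated-unifies : (θ : Subst Fn) (x : ℕ) (t : Term Fn) (ts us : List (Term Fn)) → θ x ≡ substT θ t
    → substTs θ ts ≡ substTs θ us → substTs θ (substTs (bind x t) ts) ≡ substTs θ (substTs (bind x t) us)
  eliminated-unifies θ x t ts us e unifies =
    trans (substTs-bind-invisible θ x t e ts) (trans unifies (sym (substTs-bind-invisible θ x t e us)))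

  -- Robinson's algorithm, guided by a known unifier θ: θ refutes every clash and occurs-check failure,
  -- and the size of the θ-instance of the equations strictly decreases (binding x to t leaves it unchanged).
  solve : (n : ℕ) (θ : Subst Fn) (ts us : List (Term Fn))
    → sizeTs (substTs θ ts) < n → substTs θ ts ≡ substTs θ us → Solution ts us
  solve (suc n) θ [] [] _ _ = var , refl , λ σ _ → σ , λ x → refl
  solve (suc n) θ (fn f ts′ ∷ ts) (fn g us′ ∷ us) size< e
    with refl , args≡ ← fn-injective (proj₁ (∷-injective e)) =
    solution-decompose f ts′ us′ ts us
      (trans (sym (length-substTs θ ts′)) (trans (cong length args≡) (length-substTs θ us′)))
      (solve n θ (ts′ ++ ts) (us′ ++ us)
        (subst (_< n) (sym (trans (cong sizeTs (substTs-++ θ ts′ ts)) (sizeTs-++ (substTs θ ts′) (substTs θ ts))))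
               (≤-pred size<))
        (trans (substTs-++ θ ts′ ts) (trans (cong₂ _++_ args≡ (proj₂ (∷-injective e))) (sym (substTs-++ θ us′ us)))))
  solve (suc n) θ (var x ∷ ts) (var y ∷ us) size< e with x ≟ y | ∷-injective e
  ... | yes refl | _ , rest≡ =
    solution-skip x (solve n θ ts us (<-≤-trans (n<sizeT+n (θ x) _) (≤-pred size<)) rest≡)
  ... | no x≢y | x≡y , rest≡ =
    solution-eliminate x (var y) ts us (λ { (here e′) → x≢y e′ })
      (solve n θ _ _ (eliminated-bound θ x (var y) ts x≡y size<) (eliminated-unifies θ x (var y) ts us x≡y rest≡))
  solve (suc n) θ (var x ∷ ts) (fn g us′ ∷ us) size< e with x≡t , rest≡ ← ∷-injective e =
    solution-eliminate x (fn g us′) ts us (occurs-check θ g us′ x≡t)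
      (solve n θ _ _ (eliminated-bound θ x (fn g us′) ts x≡t size<) (eliminated-unifies θ x (fn g us′) ts us x≡t rest≡))
  solve (suc n) θ (fn f ts′ ∷ ts) (var y ∷ us) size< e with t≡y , rest≡ ← ∷-injective e =
    solution-sym {var y ∷ us} {fn f ts′ ∷ ts}
      (solution-eliminate y (fn f ts′) us ts (occurs-check θ f ts′ (sym t≡y))
        (solve n θ _ _ (eliminated-bound θ y (fn f ts′) us (sym t≡y) (subst (_< suc n) (cong sizeTs e) size<))
                       (eliminated-unifies θ y (fn f ts′) us ts (sym t≡y) (sym rest≡))))

module _ {Fn Pr : Set} where

  mgu-liftA : (γ : Subst Fn) (A B : Atom Fn Pr) → MGU γ A B → MGU (liftSubst γ) (liftA A) (liftA B)
  mgu-liftA γ (atom P ts) (atom Q us) (unifies , general) = unifies′ , general′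
    where
      unifies′ : Unifier (liftSubst γ) (liftA (atom P ts)) (liftA (atom Q us))
      unifies′ = unifier-liftA γ (atom P ts) (atom Q us) unifies
      general′ : ∀ σ → Unifier σ (liftA (atom P ts)) (liftA (atom Q us)) → ∃ λ δ → ∀ x → σ x ≡ substT δ (liftSubst γ x)
      general′ σ e = δ ⊚ liftSubst δ₁ , factor
        where
          μ-solution : Solution ts us
          μ-solution = solve (suc (sizeTs (substTs γ ts))) γ ts us ≤-refl (proj₂ (atom-injective unifies))
          μ : Subst Fn
          μ = proj₁ μ-solution
          δ₁-spec : ∃ λ δ₁ → ∀ x → μ x ≡ substT δ₁ (γ x)
          δ₁-spec = general μ (cong₂ atom (proj₁ (atom-injective unifies)) (proj₁ (proj₂ μ-solution)))
          δ₁ : Subst Fn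
          δ₁ = proj₁ δ₁-spec
          δ-spec : ∃ λ δ → ∀ x → σ x ≡ substT δ (liftT (μ x))
          δ-spec = proj₂ (proj₂ μ-solution) σ (proj₂ (atom-injective e))
          δ : Subst (Fn ⊎ ℕ)
          δ = proj₁ δ-spec
          factor : ∀ x → σ x ≡ substT (δ ⊚ liftSubst δ₁) (liftT (γ x))
          factor x = begin
            σ x                                 ≡⟨ proj₂ δ-spec x ⟩
            substT δ (liftT (μ x))              ≡⟨ cong (substT δ ∘ liftT) (proj₂ δ₁-spec x) ⟩
            substT δ (liftT (substT δ₁ (γ x)))  ≡⟨ substT-liftT-∘ δ δ₁ (γ x) ⟩
            substT (δ ⊚ liftSubst δ₁) (liftT (γ x)) ∎
            where open ≡-Reasoning

module _ {S : Set} where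

  substT≡var⁻ : (δ : Subst S) (t : Term S) {v : ℕ} → substT δ t ≡ var v → t ≡ var (varOf t) × δ (varOf t) ≡ var v
  substT≡var⁻ δ (var x) e = refl , e

  ∈-varsT-shift : (K : ℕ) (t : Term S) {v : ℕ} → v ∈ varsT (substT (rename (K +_)) t) → K ≤ v
  ∈-varsT-shift K t v∈ with ∈-varsT-substT⁻ (rename (K +_)) t v∈
  ... | w , _ , here refl = m≤m+n K w

  -- A factorisation σ = δ ∘ γ in which σ fixes a variable v forces γ to rename v.
  module FixedByFactor (γ δ σ : Subst S) (factor : ∀ x → σ x ≡ substT δ (γ x)) where

    fixed-var : {v : ℕ} → σ v ≡ var v → γ v ≡ var (varOf (γ v)) × δ (varOf (γ v)) ≡ var v
    fixed-var {v} σv≡v = substT≡var⁻ δ (γ v) (trans (sym (factor v)) σv≡v)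

    fixed-injective : {a b : ℕ} → σ a ≡ var a → σ b ≡ var b → varOf (γ a) ≡ varOf (γ b) → a ≡ b
    fixed-injective σa≡a σb≡b e =
      var-injective (trans (sym (proj₂ (fixed-var σa≡a))) (trans (cong δ e) (proj₂ (fixed-var σb≡b))))

    fixed-apart : {v x : ℕ} → σ v ≡ var v → v ∉ varsT (σ x) → varOf (γ v) ∉ varsT (γ x)
    fixed-apart {v} {x} σv≡v v∉ w∈ =
      v∉ (subst (λ t → v ∈ varsT t) (sym (factor x))
            (∈-varsT-substT⁺ δ (γ x) w∈ (subst (λ t → v ∈ varsT t) (sym (proj₂ (fixed-var σv≡v))) (here refl))))

module _ {S : Set} where

  extendAt : Subst S → ℕ → Term S → Subst S
  extendAt σ u t z with z ≟ u
  ... | yes _ = substT σ t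
  ... | no _  = σ z

  extendAt-≡ : (σ : Subst S) (u : ℕ) (t : Term S) → extendAt σ u t u ≡ substT σ t
  extendAt-≡ σ u t with u ≟ u
  ... | yes _  = refl
  ... | no u≢u = ⊥-elim (u≢u refl)

  extendAt-≢ : (σ : Subst S) (u : ℕ) (t : Term S) {z : ℕ} → z ≢ u → extendAt σ u t z ≡ σ z
  extendAt-≢ σ u t {z} z≢u with z ≟ u
  ... | yes z≡u = ⊥-elim (z≢u z≡u)
  ... | no _    = refl

  substT-extendAt : (σ : Subst S) (u : ℕ) (t s : Term S) → u ∉ varsT s → substT (extendAt σ u t) s ≡ substT σ s
  substT-extendAt σ u t s u∉ = substT-cong _ σ s (λ z z∈ → extendAt-≢ σ u t (λ { refl → u∉ z∈ }))

  substTs-extendAt : (σ : Subst S) (u : ℕ) (t : Term S) (ss : List (Term S)) → u ∉ varsTs ss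
    → substTs (extendAt σ u t) ss ≡ substTs σ ss
  substTs-extendAt σ u t ss u∉ = substTs-cong _ σ ss (λ z z∈ → extendAt-≢ σ u t (λ { refl → u∉ z∈ }))

  fixing : List ℕ → Subst S → Subst S
  fixing V τ z with z ∈? V
  ... | yes _ = var z
  ... | no _  = τ z

  fixing-∈ : (V : List ℕ) (τ : Subst S) {x : ℕ} → x ∈ V → fixing V τ x ≡ var x
  fixing-∈ V τ {x} x∈ with x ∈? V
  ... | yes _  = refl
  ... | no x∉ = ⊥-elim (x∉ x∈)

  fixing-∉ : (V : List ℕ) (τ : Subst S) {x : ℕ} → x ∉ V → fixing V τ x ≡ τ x
  fixing-∉ V τ {x} x∉ with x ∈? V
  ... | yes x∈ = ⊥-elim (x∉ x∈)
  ... | no _   = refl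

module _ {S Pr : Set} where

  unifier-extendAt : (σ : Subst S) {P Q : Pr} (ts ss : List (Term S)) (t : Term S) (u : ℕ)
    → Unifier σ (atom P ts) (atom Q ss) → u ∉ varsTs ts → u ∉ varsTs ss → u ∉ varsT t
    → Unifier (extendAt σ u t) (atom P ts ⟦ t ⟧) (atom Q ss ⟦ var u ⟧)
  unifier-extendAt σ ts ss t u unifies u∉ts u∉ss u∉t =
    ⟦⟧-unifier⁺ (extendAt σ u t) ts ss t (var u) (proj₁ (atom-injective unifies))
      (trans (substTs-extendAt σ u t ts u∉ts) (trans (proj₂ (atom-injective unifies)) (sym (substTs-extendAt σ u t ss u∉ss))))
      (trans (substT-extendAt σ u t t u∉t) (sym (extendAt-≡ σ u t)))

  mgu-extendAt : (γ : Subst S) {P Q : Pr} (ts ss : List (Term S)) (t : Term S) (u : ℕ)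
    → MGU γ (atom P ts) (atom Q ss) → u ∉ varsTs ts → u ∉ varsTs ss → u ∉ varsT t
    → MGU (extendAt γ u t) (atom P ts ⟦ t ⟧) (atom Q ss ⟦ var u ⟧)
  mgu-extendAt γ {P} {Q} ts ss t u (unifies , general) u∉ts u∉ss u∉t =
    unifier-extendAt γ ts ss t u unifies u∉ts u∉ss u∉t , general′
    where
      general′ : ∀ σ → Unifier σ (atom P ts ⟦ t ⟧) (atom Q ss ⟦ var u ⟧) → ∃ λ δ → ∀ z
        → σ z ≡ substT δ (extendAt γ u t z)
      general′ σ σ-unifies = δ , factor
        where
          parts : P ≡ Q × substTs σ ts ≡ substTs σ ss × substT σ t ≡ σ u
          parts = ⟦⟧-unifier⁻ σ ts ss t (var u) σ-unifies
          δ-spec : ∃ λ δ → ∀ z → σ z ≡ substT δ (γ z)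
          δ-spec = general σ (cong₂ atom (proj₁ parts) (proj₁ (proj₂ parts)))
          δ : Subst S
          δ = proj₁ δ-spec
          factor : ∀ z → σ z ≡ substT δ (extendAt γ u t z)
          factor z with z ≟ u
          ... | yes refl = trans (sym (proj₂ (proj₂ parts)))
                                 (trans (substT-cong σ (δ ⊚ γ) t (λ x _ → proj₂ δ-spec x)) (sym (substT-∘ δ γ t)))
          ... | no _     = proj₂ δ-spec z

module _ {S : Set} where

  localise : Subst S → List ℕ → Subst S
  localise γ₁ W z with z ∈? W
  ... | yes _ = γ₁ z
  ... | no _  = var (bound (concatMap (varsT ∘ γ₁) W) + z)

  localise-∈ : (γ₁ : Subst S) (W : List ℕ) {x : ℕ} → x ∈ W → localise γ₁ W x ≡ γ₁ x
  localise-∈ γ₁ W {x} x∈ with x ∈? W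
  ... | yes _  = refl
  ... | no x∉ = ⊥-elim (x∉ x∈)

module _ {S Pr : Set} where

  mgu-localise : (γ₁ : Subst S) (A B : Atom S Pr) (W : List ℕ)
    → (∀ {x} → x ∈ varsA A → x ∈ W) → (∀ {x} → x ∈ varsA B → x ∈ W) → Unifier γ₁ A B
    → (∀ σ → Unifier σ A B → ∃ λ δ → ∀ {x} → x ∈ W → σ x ≡ substT δ (γ₁ x))
    → MGU (localise γ₁ W) A B
  mgu-localise γ₁ A B W A⊆W B⊆W unifies general = unifies′ , general′
    where
      K : ℕ
      K = bound (concatMap (varsT ∘ γ₁) W)
      on : (C : Atom S Pr) → (∀ {x} → x ∈ varsA C → x ∈ W) → substA (localise γ₁ W) C ≡ substA γ₁ C
      on C C⊆W = substA-cong _ γ₁ C (λ x x∈ → localise-∈ γ₁ W (C⊆W x∈))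
      unifies′ : Unifier (localise γ₁ W) A B
      unifies′ = trans (on A A⊆W) (trans unifies (sym (on B B⊆W)))
      general′ : ∀ σ → Unifier σ A B → ∃ λ δ → ∀ x → σ x ≡ substT δ (localise γ₁ W x)
      general′ σ σ-unifies = δ , factor
        where
          δ₁-spec : ∃ λ δ₁ → ∀ {x} → x ∈ W → σ x ≡ substT δ₁ (γ₁ x)
          δ₁-spec = general σ σ-unifies
          -- the fresh variable K + z is where localise sends z ∉ W, so δ maps it back to σ z
          δ : Subst S
          δ v with K ≤? v
          ... | yes _ = σ (v ∸ K)
          ... | no _  = proj₁ δ₁-spec v
          δ-low : ∀ {v} → v < K → δ v ≡ proj₁ δ₁-spec v
          δ-low {v} v<K with K ≤? v
          ... | yes K≤v = ⊥-elim (<-irrefl refl (<-≤-trans v<K K≤v))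
          ... | no _    = refl
          δ-high : ∀ x → δ (K + x) ≡ σ x
          δ-high x with K ≤? K + x
          ... | yes _    = cong σ (m+n∸m≡n K x)
          ... | no K≰K+x = ⊥-elim (K≰K+x (m≤m+n K x))
          factor : ∀ x → σ x ≡ substT δ (localise γ₁ W x)
          factor x with x ∈? W
          ... | yes x∈ = trans (proj₂ δ₁-spec x∈)
                           (substT-cong _ δ (γ₁ x) (λ v v∈ → sym (δ-low (∈⇒<bound (concatMap (varsT ∘ γ₁) W)
                                                                      (∈-concatMap⁺ (varsT ∘ γ₁) (Any.map (λ { refl → v∈ }) x∈))))))
          ... | no _   = sym (δ-high x)

-- Renaming apart

renamedClauseVars : {S Pr : Set} {Φ : Program S Pr} {G G′ : Goal S Pr} → Φ ⊢ G ⇝ G′ → List ℕ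
renamedClauseVars (step c _ ρ _ _ _ _) = varsC (renameC ρ c)

module Renaming {S Pr : Set} (π : ℕ ↔ ℕ) where

  open Inverse π

  π̂ : Subst S
  π̂ = rename to

  to-injective : ∀ {x y} → to x ≡ to y → x ≡ y
  to-injective {x} {y} e = trans (sym (strictlyInverseʳ x)) (trans (cong from e) (strictlyInverseʳ y))

  conjugate : Subst S → Subst S
  conjugate γ v = substT π̂ (γ (from v))

  substA-conjugate : (γ : Subst S) (A : Atom S Pr) → substA (conjugate γ) (substA π̂ A) ≡ substA π̂ (substA γ A)
  substA-conjugate γ A =
    trans (substA-∘ (conjugate γ) π̂ A)
          (trans (substA-cong _ (π̂ ⊚ γ) A (λ x _ → cong (substT π̂ ∘ γ) (strictlyInverseʳ x))) (sym (substA-∘ π̂ γ A)))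

  substG-conjugate : (γ : Subst S) (G : Goal S Pr) → substG (conjugate γ) (substG π̂ G) ≡ substG π̂ (substG γ G)
  substG-conjugate γ []      = refl
  substG-conjugate γ (A ∷ G) = cong₂ _∷_ (substA-conjugate γ A) (substG-conjugate γ G)

  mgu-rename : (γ : Subst S) (A B : Atom S Pr) → MGU γ A B → MGU (conjugate γ) (substA π̂ A) (substA π̂ B)
  mgu-rename γ A B (unifies , general) =
    trans (substA-conjugate γ A) (trans (cong (substA π̂) unifies) (sym (substA-conjugate γ B))) , general′
    where
      general′ : ∀ σ → Unifier σ (substA π̂ A) (substA π̂ B) → ∃ λ δ → ∀ v → σ v ≡ substT δ (conjugate γ v)
      general′ σ σ-unifies = δ ∘ from , factor
        where
          δ-spec : ∃ λ δ → ∀ x → substT σ (π̂ x) ≡ substT δ (γ x)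
          δ-spec = general (σ ⊚ π̂) (trans (sym (substA-∘ σ π̂ A)) (trans σ-unifies (substA-∘ σ π̂ B)))
          δ : Subst S
          δ = proj₁ δ-spec
          factor : ∀ v → σ v ≡ substT (δ ∘ from) (conjugate γ v)
          factor v = begin
            σ v                                  ≡⟨ cong σ (sym (strictlyInverseˡ v)) ⟩
            σ (to (from v))                      ≡⟨ proj₂ δ-spec (from v) ⟩
            substT δ (γ (from v))                ≡⟨ substT-cong δ _ (γ (from v)) (λ x _ → cong δ (sym (strictlyInverseʳ x))) ⟩
            substT ((δ ∘ from) ⊚ π̂) (γ (from v)) ≡⟨ sym (substT-∘ (δ ∘ from) π̂ (γ (from v))) ⟩
            substT (δ ∘ from) (conjugate γ v)    ∎
            where open ≡-Reasoning

  record RenamedStep {Φ : Program S Pr} {G G′ : Goal S Pr} (s : Φ ⊢ G ⇝ G′) : Set where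
    field
      {source target} : Goal S Pr
      step′           : Φ ⊢ source ⇝ target
      source≡         : source ≡ substG π̂ G
      target≡         : target ≡ substG π̂ G′
      clause-vars     : ∀ {x} → x ∈ renamedClauseVars step′ → ∃ λ y → y ∈ renamedClauseVars s × x ≡ to y

  ⇝-rename : {Φ : Program S Pr} {G G′ : Goal S Pr} (s : Φ ⊢ G ⇝ G′) → RenamedStep s
  ⇝-rename (step {xs} {A} {zs} (C ⇐ Bs) c∈ ρ ρ-inj c-fresh γ mgu) = record
    { step′       = step (C ⇐ Bs) c∈ (to ∘ ρ) (ρ-inj ∘ to-injective) c-fresh′ (conjugate γ) mgu′
    ; source≡     = sym (substG-++ π̂ xs (A ∷ zs))
    ; target≡     = target≡
    ; clause-vars = λ x∈ → let j , j∈ , x≡ = ∈-varsC-rename⁻ (to ∘ ρ) (C ⇐ Bs) x∈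
                           in ρ j , ∈-varsC-rename⁺ ρ (C ⇐ Bs) j∈ , x≡
    }
    where
      mgu′ : MGU (conjugate γ) (substA (rename (to ∘ ρ)) C) (substA π̂ A)
      mgu′ = subst (λ h → MGU (conjugate γ) h (substA π̂ A)) (substA-∘ π̂ (rename ρ) C) (mgu-rename γ _ A mgu)
      c-fresh′ : ∀ x → x ∈ varsC (renameC (to ∘ ρ) (C ⇐ Bs)) → x ∉ varsG (substG π̂ xs ++ substA π̂ A ∷ substG π̂ zs)
      c-fresh′ x x∈ x∈G with ∈-varsC-rename⁻ (to ∘ ρ) (C ⇐ Bs) x∈
                           | ∈-varsG-substG⁻ π̂ (xs ++ A ∷ zs)
                               (subst (λ H → x ∈ varsG H) (sym (substG-++ π̂ xs (A ∷ zs))) x∈G)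
      ... | j , j∈ , refl | w , w∈ , here e =
        c-fresh (ρ j) (∈-varsC-rename⁺ ρ (C ⇐ Bs) j∈) (subst (_∈ varsG (xs ++ A ∷ zs)) (sym (to-injective e)) w∈)
      target≡ : substG (conjugate γ) (substG π̂ xs ++ substG (rename (to ∘ ρ)) Bs ++ substG π̂ zs)
                ≡ substG π̂ (substG γ (xs ++ substG (rename ρ) Bs ++ zs))
      target≡ = begin
        substG (conjugate γ) (substG π̂ xs ++ substG (rename (to ∘ ρ)) Bs ++ substG π̂ zs)
          ≡⟨ cong (λ B → substG (conjugate γ) (substG π̂ xs ++ B ++ substG π̂ zs)) (sym (substG-∘ π̂ (rename ρ) Bs)) ⟩
        substG (conjugate γ) (substG π̂ xs ++ substG π̂ (substG (rename ρ) Bs) ++ substG π̂ zs)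
          ≡⟨ cong (substG (conjugate γ)) (sym (trans (substG-++ π̂ xs _) (cong (substG π̂ xs ++_) (substG-++ π̂ _ zs)))) ⟩
        substG (conjugate γ) (substG π̂ (xs ++ substG (rename ρ) Bs ++ zs))
          ≡⟨ substG-conjugate γ _ ⟩
        substG π̂ (substG γ (xs ++ substG (rename ρ) Bs ++ zs)) ∎
        where open ≡-Reasoning

-- The involution exchanging each w ∈ ws with w + K, for K above ws.
module SwapAbove (ws : List ℕ) (K : ℕ) (ws<K : ∀ {w} → w ∈ ws → w < K) where

  swap : ℕ → ℕ
  swap z with z ∈? ws
  ... | yes _ = z + K
  ... | no _ with K ≤? z
  ...   | no _  = z
  ...   | yes _ with z ∸ K ∈? ws
  ...     | yes _ = z ∸ K
  ...     | no _  = z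

  swap-∈ : ∀ {z} → z ∈ ws → swap z ≡ z + K
  swap-∈ {z} z∈ with z ∈? ws
  ... | yes _  = refl
  ... | no z∉ = ⊥-elim (z∉ z∈)

  swap-below : ∀ {z} → z ∉ ws → z < K → swap z ≡ z
  swap-below {z} z∉ z<K with z ∈? ws
  ... | yes z∈ = ⊥-elim (z∉ z∈)
  ... | no _ with K ≤? z
  ...   | no _    = refl
  ...   | yes K≤z = ⊥-elim (<-irrefl refl (<-≤-trans z<K K≤z))

  swap-back : ∀ {z} → z ∉ ws → K ≤ z → z ∸ K ∈ ws → swap z ≡ z ∸ K
  swap-back {z} z∉ K≤z z-K∈ with z ∈? ws
  ... | yes z∈ = ⊥-elim (z∉ z∈)
  ... | no _ with K ≤? z
  ...   | no K≰z = ⊥-elim (K≰z K≤z)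
  ...   | yes _ with z ∸ K ∈? ws
  ...     | yes _     = refl
  ...     | no z-K∉ = ⊥-elim (z-K∉ z-K∈)

  swap-fixed : ∀ {z} → z ∉ ws → K ≤ z → z ∸ K ∉ ws → swap z ≡ z
  swap-fixed {z} z∉ K≤z z-K∉ with z ∈? ws
  ... | yes z∈ = ⊥-elim (z∉ z∈)
  ... | no _ with K ≤? z
  ...   | no K≰z = ⊥-elim (K≰z K≤z)
  ...   | yes _ with z ∸ K ∈? ws
  ...     | yes z-K∈ = ⊥-elim (z-K∉ z-K∈)
  ...     | no _      = refl

  swap-involutive : ∀ z → swap (swap z) ≡ z
  swap-involutive z = cases (z ∈? ws) (K ≤? z) (z ∸ K ∈? ws)
    where
      cases : Dec (z ∈ ws) → Dec (K ≤ z) → Dec (z ∸ K ∈ ws) → swap (swap z) ≡ z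
      cases (yes z∈) _ _ = begin
        swap (swap z)   ≡⟨ cong swap (swap-∈ z∈) ⟩
        swap (z + K)    ≡⟨ swap-back (λ z+K∈ → <-irrefl refl (<-≤-trans (ws<K z+K∈) (m≤n+m K z))) (m≤n+m K z)
                                     (subst (_∈ ws) (sym (m+n∸n≡m z K)) z∈) ⟩
        z + K ∸ K       ≡⟨ m+n∸n≡m z K ⟩
        z               ∎
        where open ≡-Reasoning
      cases (no z∉) (no K≰z) _ = trans (cong swap (swap-below z∉ (≰⇒> K≰z))) (swap-below z∉ (≰⇒> K≰z))
      cases (no z∉) (yes K≤z) (yes z-K∈) =
        trans (cong swap (swap-back z∉ K≤z z-K∈)) (trans (swap-∈ z-K∈) (m∸n+n≡m K≤z))
      cases (no z∉) (yes K≤z) (no z-K∉) = trans (cong swap (swap-fixed z∉ K≤z z-K∉)) (swap-fixed z∉ K≤z z-K∉)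

  swap↔ : ℕ ↔ ℕ
  swap↔ = mk↔ₛ′ swap swap swap-involutive swap-involutive

  swap-∉ : ∀ {z} → z < K → swap z ∉ ws
  swap-∉ {z} z<K = cases (z ∈? ws)
    where
      cases : Dec (z ∈ ws) → swap z ∉ ws
      cases (yes z∈) = subst (_∉ ws) (sym (swap-∈ z∈)) (λ z+K∈ → <-irrefl refl (<-≤-trans (ws<K z+K∈) (m≤n+m K z)))
      cases (no z∉)  = subst (_∉ ws) (sym (swap-below z∉ z<K)) z∉

module _ {Fn Pr : Set} where

  realizeGoal : Goal Fn Pr → List ℕ → Goal (Fn ⊎ ℕ) Pr
  realizeGoal = List.zipWith (λ A y → liftA A ⟦ var y ⟧)

  record Fresh (G : Goal Fn Pr) (ws : List ℕ) : Set where
    constructor fresh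
    field
      length≡  : length ws ≡ length G
      distinct : Distinct ws
      apart    : ∀ {w} → w ∈ ws → w ∉ varsG G

  varsA-realized : (A : Atom Fn Pr) (w : ℕ) → varsA (liftA A ⟦ var w ⟧) ≡ varsA A ++ [ w ]
  varsA-realized A w = trans (varsA-⟦⟧ (liftA A) (var w)) (cong (_++ [ w ]) (varsA-liftA A))

  realizeGoal-++ : (G H : Goal Fn Pr) (ws vs : List ℕ) → length ws ≡ length G
    → realizeGoal (G ++ H) (ws ++ vs) ≡ realizeGoal G ws ++ realizeGoal H vs
  realizeGoal-++ []      H []       vs l = refl
  realizeGoal-++ (A ∷ G) H (w ∷ ws) vs l = cong (_ ∷_) (realizeGoal-++ G H ws vs (suc-injective l))

  realizeGoal≡[] : (G : Goal Fn Pr) (ws : List ℕ) → length ws ≡ length G → realizeGoal G ws ≡ [] → G ≡ []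
  realizeGoal≡[] []      []       l  e = refl
  realizeGoal≡[] (A ∷ G) (w ∷ ws) l ()

  ∈-varsG-realizeGoal⁻ : (G : Goal Fn Pr) (ws : List ℕ) {v : ℕ} → v ∈ varsG (realizeGoal G ws) → v ∈ varsG G ⊎ v ∈ ws
  ∈-varsG-realizeGoal⁻ (A ∷ G) (w ∷ ws) v∈ with ∈-++⁻ (varsA (liftA A ⟦ var w ⟧)) v∈
  ... | inj₂ v∈G = Sum.map (∈-++⁺ʳ (varsA A)) there (∈-varsG-realizeGoal⁻ G ws v∈G)
  ... | inj₁ v∈A with ∈-++⁻ (varsA A) (subst (_ ∈_) (varsA-realized A w) v∈A)
  ...   | inj₁ v∈A′       = inj₁ (∈-++⁺ˡ v∈A′)
  ...   | inj₂ (here v≡w) = inj₂ (here v≡w)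

  ∈-varsG-realizeGoal⁺ : (G : Goal Fn Pr) (ws : List ℕ) {v : ℕ} → length ws ≡ length G
    → v ∈ varsG G ⊎ v ∈ ws → v ∈ varsG (realizeGoal G ws)
  ∈-varsG-realizeGoal⁺ (A ∷ G) (w ∷ ws) l (inj₁ v∈) with ∈-++⁻ (varsA A) v∈
  ... | inj₁ v∈A = ∈-++⁺ˡ (subst (_ ∈_) (sym (varsA-realized A w)) (∈-++⁺ˡ v∈A))
  ... | inj₂ v∈G = ∈-++⁺ʳ (varsA (liftA A ⟦ var w ⟧)) (∈-varsG-realizeGoal⁺ G ws (suc-injective l) (inj₁ v∈G))
  ∈-varsG-realizeGoal⁺ (A ∷ G) (w ∷ ws) l (inj₂ (here refl)) =
    ∈-++⁺ˡ (subst (_ ∈_) (sym (varsA-realized A w)) (∈-++⁺ʳ (varsA A) (here refl)))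
  ∈-varsG-realizeGoal⁺ (A ∷ G) (w ∷ ws) l (inj₂ (there v∈)) =
    ∈-++⁺ʳ (varsA (liftA A ⟦ var w ⟧)) (∈-varsG-realizeGoal⁺ G ws (suc-injective l) (inj₂ v∈))

  substA-liftA : (γ′ : Subst (Fn ⊎ ℕ)) (γ : Subst Fn) (A : Atom Fn Pr)
    → (∀ x → x ∈ varsA A → γ′ x ≡ liftT (γ x)) → substA γ′ (liftA A) ≡ liftA (substA γ A)
  substA-liftA γ′ γ A h =
    trans (substA-cong γ′ (liftSubst γ) (liftA A) (λ x x∈ → h x (subst (x ∈_) (varsA-liftA A) x∈))) (sym (liftA-substA γ A))

  substG-realizeGoal : (γ′ : Subst (Fn ⊎ ℕ)) (γ : Subst Fn) (g : ℕ → ℕ) (G : Goal Fn Pr) (ws : List ℕ)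
    → (∀ x → x ∈ varsG G → γ′ x ≡ liftT (γ x)) → (∀ w → w ∈ ws → γ′ w ≡ var (g w))
    → substG γ′ (realizeGoal G ws) ≡ realizeGoal (substG γ G) (map g ws)
  substG-realizeGoal γ′ γ g []      ws       hG hw = refl
  substG-realizeGoal γ′ γ g (A ∷ G) []       hG hw = refl
  substG-realizeGoal γ′ γ g (A ∷ G) (w ∷ ws) hG hw =
    cong₂ _∷_ (trans (substA-⟦⟧ γ′ (liftA A) (var w))
                     (cong₂ _⟦_⟧ (substA-liftA γ′ γ A (λ x x∈ → hG x (∈-++⁺ˡ x∈))) (hw w (here refl))))
              (substG-realizeGoal γ′ γ g G ws (λ x x∈ → hG x (∈-++⁺ʳ (varsA A) x∈)) (λ v v∈ → hw v (there v∈)))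

  record RealizedSplit (G : Goal Fn Pr) (ws : List ℕ)
                       (xs′ : Goal (Fn ⊎ ℕ) Pr) (A′ : Atom (Fn ⊎ ℕ) Pr) (zs′ : Goal (Fn ⊎ ℕ) Pr) : Set where
    field
      xs zs    : Goal Fn Pr
      A        : Atom Fn Pr
      ws₁ ws₂  : List ℕ
      u        : ℕ
      G≡       : G ≡ xs ++ A ∷ zs
      ws≡      : ws ≡ ws₁ ++ u ∷ ws₂
      length₁  : length ws₁ ≡ length xs
      length₂  : length ws₂ ≡ length zs
      xs′≡     : xs′ ≡ realizeGoal xs ws₁
      A′≡      : A′ ≡ liftA A ⟦ var u ⟧
      zs′≡     : zs′ ≡ realizeGoal zs ws₂

  realizeGoal-split : (G : Goal Fn Pr) (ws : List ℕ) (xs′ : Goal (Fn ⊎ ℕ) Pr)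
    {A′ : Atom (Fn ⊎ ℕ) Pr} {zs′ : Goal (Fn ⊎ ℕ) Pr}
    → length ws ≡ length G → realizeGoal G ws ≡ xs′ ++ A′ ∷ zs′ → RealizedSplit G ws xs′ A′ zs′
  realizeGoal-split (B ∷ G) (w ∷ ws) [] l e = record
    { xs = [] ; A = B ; zs = G ; ws₁ = [] ; u = w ; ws₂ = ws ; G≡ = refl ; ws≡ = refl
    ; length₁ = refl ; length₂ = suc-injective l ; xs′≡ = refl
    ; A′≡ = sym (proj₁ (∷-injective e)) ; zs′≡ = sym (proj₂ (∷-injective e)) }
  realizeGoal-split (B ∷ G) (w ∷ ws) (X ∷ xs′) l e =
    let r = realizeGoal-split G ws xs′ (suc-injective l) (proj₂ (∷-injective e))
        open RealizedSplit r
    in record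
      { xs = B ∷ xs ; A = A ; zs = zs ; ws₁ = w ∷ ws₁ ; u = u ; ws₂ = ws₂ ; G≡ = cong (B ∷_) G≡ ; ws≡ = cong (w ∷_) ws≡
      ; length₁ = cong suc length₁ ; length₂ = length₂ ; xs′≡ = cong₂ _∷_ (sym (proj₁ (∷-injective e))) xs′≡
      ; A′≡ = A′≡ ; zs′≡ = zs′≡ }

  witnessVars : Clause Fn Pr → List ℕ
  witnessVars (C ⇐ Bs) = applyUpTo (λ j → suc (maxVarC (C ⇐ Bs)) + j) (length Bs)

  varsC<witnessVars : (c : Clause Fn Pr) {x y : ℕ} → x ∈ varsC c → y ∈ witnessVars c → x < y
  varsC<witnessVars (C ⇐ Bs) x∈ y∈ with ∈-applyUpTo⁻ (λ j → suc (maxVarC (C ⇐ Bs)) + j) y∈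
  ... | j , _ , refl = <-≤-trans (∈⇒<bound (varsC (C ⇐ Bs)) x∈) (m≤m+n _ j)

  witnessVars-distinct : (c : Clause Fn Pr) → Distinct (witnessVars c)
  witnessVars-distinct (C ⇐ Bs) = Distinct-applyUpTo _ (length Bs) (+-cancelˡ-≡ (suc (maxVarC (C ⇐ Bs))) _ _)

  length-witnessVars : (C : Atom Fn Pr) (Bs : Goal Fn Pr) → length (witnessVars (C ⇐ Bs)) ≡ length Bs
  length-witnessVars C Bs = length-applyUpTo _ (length Bs)

  realizedClause : ℕ → Atom Fn Pr → Goal Fn Pr → List ℕ → Clause (Fn ⊎ ℕ) Pr
  realizedClause κ C Bs ys = (liftA C ⟦ fn (inj₂ κ) (map var ys) ⟧) ⇐ realizeGoal Bs ys

  renameC-realizeClause : (κ : ℕ) (C : Atom Fn Pr) (Bs : Goal Fn Pr) (ρ : ℕ → ℕ)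
    → renameC ρ (realizeClause κ (C ⇐ Bs))
      ≡ realizedClause κ (substA (rename ρ) C) (substG (rename ρ) Bs) (map ρ (witnessVars (C ⇐ Bs)))
  renameC-realizeClause κ C Bs ρ = cong₂ _⇐_
    (trans (substA-⟦⟧ (rename ρ) (liftA C) _)
           (cong₂ _⟦_⟧ (sym (liftA-substA (rename ρ) C))
                       (cong (fn (inj₂ κ)) (trans (substTs-map-var (rename ρ) _) (map-∘ (witnessVars (C ⇐ Bs)))))))
    (substG-realizeGoal (rename ρ) (rename ρ) ρ Bs (witnessVars (C ⇐ Bs)) (λ _ _ → refl) (λ _ _ → refl))

  renameC-realizeClause-above : (κ : ℕ) (C : Atom Fn Pr) (Bs : Goal Fn Pr) (ρ : ℕ → ℕ) (M : ℕ)
    → (∀ {x} → x ∈ varsC (C ⇐ Bs) → ρ x < M)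
    → renameC (patchAbove (varsC (C ⇐ Bs)) ρ M) (realizeClause κ (C ⇐ Bs))
      ≡ realizedClause κ (substA (rename ρ) C) (substG (rename ρ) Bs) (map (M +_) (witnessVars (C ⇐ Bs)))
  renameC-realizeClause-above κ C Bs ρ M ρ<M =
    trans (renameC-realizeClause κ C Bs ρ′)
          (cong₂ (λ C′ (Bs′,ys : Goal Fn Pr × List ℕ) → realizedClause κ C′ (proj₁ Bs′,ys) (proj₂ Bs′,ys))
                 (sym (proj₁ same)) (cong₂ _,_ (sym (proj₂ same)) witnesses-above))
    where
      ρ′ : ℕ → ℕ
      ρ′ = patchAbove (varsC (C ⇐ Bs)) ρ M
      same : substA (rename ρ) C ≡ substA (rename ρ′) C × substG (rename ρ) Bs ≡ substG (rename ρ′) Bs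
      same = renameC-cong ρ ρ′ C Bs (λ x∈ → sym (patchAbove-∈ (varsC (C ⇐ Bs)) ρ M x∈))
      witnesses-above : map ρ′ (witnessVars (C ⇐ Bs)) ≡ map (M +_) (witnessVars (C ⇐ Bs))
      witnesses-above = map-cong-local (All.tabulate (λ y∈ →
        patchAbove-∉ (varsC (C ⇐ Bs)) ρ M (λ y∈c → <-irrefl refl (varsC<witnessVars (C ⇐ Bs) y∈c y∈))))

  private
    realized-head-vars : (κ : ℕ) (C : Atom Fn Pr) (ys : List ℕ)
      → varsA (liftA C ⟦ fn (inj₂ κ) (map var ys) ⟧) ≡ varsA C ++ ys
    realized-head-vars κ C ys = trans (varsA-⟦⟧ (liftA C) _) (cong₂ _++_ (varsA-liftA C) (varsTs-map-var ys))

  ∈-varsC-realizedClause⁺ : (κ : ℕ) (C : Atom Fn Pr) (Bs : Goal Fn Pr) (ys : List ℕ) {x : ℕ} → length ys ≡ length Bs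
    → x ∈ varsC (C ⇐ Bs) ⊎ x ∈ ys → x ∈ varsC (realizedClause κ C Bs ys)
  ∈-varsC-realizedClause⁺ κ C Bs ys {x} l (inj₁ x∈) with ∈-++⁻ (varsA C) x∈
  ... | inj₁ x∈C  = ∈-++⁺ˡ (subst (x ∈_) (sym (realized-head-vars κ C ys)) (∈-++⁺ˡ x∈C))
  ... | inj₂ x∈Bs = ∈-++⁺ʳ (varsA (liftA C ⟦ fn (inj₂ κ) (map var ys) ⟧)) (∈-varsG-realizeGoal⁺ Bs ys l (inj₁ x∈Bs))
  ∈-varsC-realizedClause⁺ κ C Bs ys {x} l (inj₂ x∈ys) =
    ∈-++⁺ˡ (subst (x ∈_) (sym (realized-head-vars κ C ys)) (∈-++⁺ʳ (varsA C) x∈ys))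

  ∈-varsC-realizedClause⁻ : (κ : ℕ) (C : Atom Fn Pr) (Bs : Goal Fn Pr) (ys : List ℕ) {x : ℕ}
    → x ∈ varsC (realizedClause κ C Bs ys) → x ∈ varsC (C ⇐ Bs) ⊎ x ∈ ys
  ∈-varsC-realizedClause⁻ κ C Bs ys {x} x∈ with ∈-++⁻ (varsA (liftA C ⟦ fn (inj₂ κ) (map var ys) ⟧)) x∈
  ... | inj₁ x∈H  = Sum.map₁ ∈-++⁺ˡ (∈-++⁻ (varsA C) (subst (x ∈_) (realized-head-vars κ C ys) x∈H))
  ... | inj₂ x∈Bs = Sum.map₁ (∈-++⁺ʳ (varsA C)) (∈-varsG-realizeGoal⁻ Bs ys x∈Bs)

  ∈-realizeFrom⁻ : (k : ℕ) (Φ : Program Fn Pr) {c′ : Clause (Fn ⊎ ℕ) Pr}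
    → c′ ∈ realizeFrom k Φ → ∃ λ κ → ∃ λ c → c ∈ Φ × c′ ≡ realizeClause κ c
  ∈-realizeFrom⁻ k (c ∷ Φ) (here e)  = k , c , here refl , e
  ∈-realizeFrom⁻ k (c ∷ Φ) (there c′∈) =
    let κ , d , d∈ , e = ∈-realizeFrom⁻ (suc k) Φ c′∈ in κ , d , there d∈ , e

  ∈-realizeFrom⁺ : (k : ℕ) (Φ : Program Fn Pr) {c : Clause Fn Pr} → c ∈ Φ → ∃ λ κ → realizeClause κ c ∈ realizeFrom k Φ
  ∈-realizeFrom⁺ k (d ∷ Φ) (here refl) = k , here refl
  ∈-realizeFrom⁺ k (d ∷ Φ) (there c∈)  = let κ , c′∈ = ∈-realizeFrom⁺ (suc k) Φ c∈ in κ , there c′∈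

-- The goal xs ++ A ∷ zs carries the witnesses ws₁ ++ u ∷ ws₂, u being that of the selected atom A;
-- C₁ ⇐ Bs₁ is the renamed clause and ys are the witnesses of Bs₁.
module StepLayout {Fn Pr : Set} (κ : ℕ) (P Q : Pr) (ts ss : List (Term Fn)) (xs zs Bs₁ : Goal Fn Pr)
  (ws₁ ws₂ ys : List ℕ) (u : ℕ)
  (length₁ : length ws₁ ≡ length xs) (length₂ : length ws₂ ≡ length zs) (length₃ : length ys ≡ length Bs₁)
  (ws-distinct : Distinct (ws₁ ++ u ∷ ws₂)) (ys-distinct : Distinct ys)
  (ws-fresh : ∀ {w} → w ∈ ws₁ ++ u ∷ ws₂ → w ∉ varsG (xs ++ atom Q ss ∷ zs))
  (clause-fresh : ∀ {x} → x ∈ varsC (atom P ts ⇐ Bs₁) ⊎ x ∈ ys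
                 → x ∉ varsG (xs ++ atom Q ss ∷ zs) × x ∉ ws₁ ++ u ∷ ws₂)
  (ys-fresh : ∀ {y} → y ∈ ys → y ∉ varsC (atom P ts ⇐ Bs₁))
  where

  A C₁ : Atom Fn Pr
  A  = atom Q ss
  C₁ = atom P ts

  fκ : Term (Fn ⊎ ℕ)
  fκ = fn (inj₂ κ) (map var ys)

  resolvent : Goal Fn Pr
  resolvent = xs ++ Bs₁ ++ zs

  vs : List ℕ
  vs = ws₁ ++ ys ++ ws₂

  W : List ℕ
  W = varsC (C₁ ⇐ Bs₁) ++ varsG (xs ++ A ∷ zs)

  W-head : ∀ {x} → x ∈ varsA C₁ → x ∈ W
  W-head = ∈-++⁺ˡ ∘ ∈-++⁺ˡ

  W-atom : ∀ {x} → x ∈ varsA A → x ∈ W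
  W-atom = ∈-++⁺ʳ (varsC (C₁ ⇐ Bs₁)) ∘ ∈-varsG-++⁺ʳ xs (A ∷ zs) ∘ ∈-++⁺ˡ

  W-resolvent : ∀ {x} → x ∈ varsG resolvent → x ∈ W
  W-resolvent x∈ with ∈-varsG-++⁻ xs (Bs₁ ++ zs) x∈
  ... | inj₁ x∈xs = ∈-++⁺ʳ (varsC (C₁ ⇐ Bs₁)) (∈-varsG-++⁺ˡ xs (A ∷ zs) x∈xs)
  ... | inj₂ x∈′ with ∈-varsG-++⁻ Bs₁ zs x∈′
  ...   | inj₁ x∈Bs = ∈-++⁺ˡ (∈-++⁺ʳ (varsA C₁) x∈Bs)
  ...   | inj₂ x∈zs = ∈-++⁺ʳ (varsC (C₁ ⇐ Bs₁)) (∈-varsG-++⁺ʳ xs (A ∷ zs) (∈-++⁺ʳ (varsA A) x∈zs))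

  private
    ws-split : Distinct ws₁ × Distinct (u ∷ ws₂) × (∀ {x} → x ∈ ws₁ → x ∉ u ∷ ws₂)
    ws-split = Distinct-++⁻ ws₁ ws-distinct

  u∈ws : u ∈ ws₁ ++ u ∷ ws₂
  u∈ws = ∈-++⁺ʳ ws₁ (here refl)

  vs⊆ws∪ys : ∀ {v} → v ∈ vs → v ∈ ws₁ ++ u ∷ ws₂ ⊎ v ∈ ys
  vs⊆ws∪ys v∈ with ∈-++⁻ ws₁ v∈
  ... | inj₁ v∈ws₁ = inj₁ (∈-++⁺ˡ v∈ws₁)
  ... | inj₂ v∈′ with ∈-++⁻ ys v∈′
  ...   | inj₁ v∈ys  = inj₂ v∈ys
  ...   | inj₂ v∈ws₂ = inj₁ (∈-++⁺ʳ ws₁ (there v∈ws₂))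

  ws-apart-W : ∀ {w} → w ∈ ws₁ ++ u ∷ ws₂ → w ∉ W
  ws-apart-W w∈ w∈W with ∈-++⁻ (varsC (C₁ ⇐ Bs₁)) w∈W
  ... | inj₁ w∈C = proj₂ (clause-fresh (inj₁ w∈C)) w∈
  ... | inj₂ w∈G = ws-fresh w∈ w∈G

  vs-apart-W : ∀ {v} → v ∈ vs → v ∉ W
  vs-apart-W v∈ v∈W with vs⊆ws∪ys v∈ | ∈-++⁻ (varsC (C₁ ⇐ Bs₁)) v∈W
  ... | inj₁ v∈ws | _          = ws-apart-W v∈ws v∈W
  ... | inj₂ v∈ys | inj₁ v∈C   = ys-fresh v∈ys v∈C
  ... | inj₂ v∈ys | inj₂ v∈G   = proj₁ (clause-fresh (inj₂ v∈ys)) v∈G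

  shift : Subst Fn
  shift = rename (bound vs +_)

  -- A unifier of C₁ and A when θ is one, fixing vs and moving W above vs. Factoring it through the mgu of the
  -- step (FixedByFactor) shows that the mgu renames vs injectively and apart from W.
  pinned : Subst Fn → Subst Fn
  pinned θ = fixing vs (shift ⊚ θ)

  pinned-vs : (θ : Subst Fn) {v : ℕ} → v ∈ vs → pinned θ v ≡ var v
  pinned-vs θ = fixing-∈ vs (shift ⊚ θ)

  pinned-W : (θ : Subst Fn) {x : ℕ} → x ∈ W → pinned θ x ≡ substT shift (θ x)
  pinned-W θ x∈ = fixing-∉ vs (shift ⊚ θ) (λ x∈vs → vs-apart-W x∈vs x∈)

  pinned-apart : (θ : Subst Fn) {v x : ℕ} → v ∈ vs → x ∈ W → v ∉ varsT (pinned θ x)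
  pinned-apart θ {v} {x} v∈ x∈ v∈′ =
    <-irrefl refl (<-≤-trans (∈⇒<bound vs v∈)
      (∈-varsT-shift (bound vs) (θ x) (subst (λ t → v ∈ varsT t) (pinned-W θ x∈) v∈′)))

  pinned-unifies : (θ : Subst Fn) → Unifier θ C₁ A → Unifier (pinned θ) C₁ A
  pinned-unifies θ unifies = begin
    substA (pinned θ) C₁           ≡⟨ substA-cong _ (shift ⊚ θ) C₁ (λ x x∈ → pinned-W θ (W-head x∈)) ⟩
    substA (shift ⊚ θ) C₁          ≡⟨ sym (substA-∘ shift θ C₁) ⟩
    substA shift (substA θ C₁)     ≡⟨ cong (substA shift) unifies ⟩
    substA shift (substA θ A)      ≡⟨ substA-∘ shift θ A ⟩
    substA (shift ⊚ θ) A           ≡⟨ sym (substA-cong _ (shift ⊚ θ) A (λ x x∈ → pinned-W θ (W-atom x∈))) ⟩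
    substA (pinned θ) A            ∎
    where open ≡-Reasoning

  u∉W : u ∉ W
  u∉W = ws-apart-W u∈ws

  u∉liftA-head : u ∉ varsA (liftA C₁)
  u∉liftA-head = u∉W ∘ W-head ∘ subst (u ∈_) (varsA-liftA C₁)

  u∉liftA-atom : u ∉ varsA (liftA A)
  u∉liftA-atom = u∉W ∘ W-atom ∘ subst (u ∈_) (varsA-liftA A)

  u∉vs : u ∉ vs
  u∉vs u∈ with ∈-++⁻ ws₁ u∈
  ... | inj₁ u∈ws₁ = proj₂ (proj₂ ws-split) u∈ws₁ (here refl)
  ... | inj₂ u∈′ with ∈-++⁻ ys u∈′ | proj₁ (proj₂ ws-split)
  ...   | inj₁ u∈ys  | _        = proj₂ (clause-fresh (inj₂ u∈ys)) u∈ws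
  ...   | inj₂ u∈ws₂ | u∉ ∷ _ = u∉ u∈ws₂

  u∉ys : u ∉ varsTs {Fn ⊎ ℕ} (map var ys)
  u∉ys = u∉vs ∘ ∈-++⁺ʳ ws₁ ∘ ∈-++⁺ˡ ∘ subst (u ∈_) (varsTs-map-var ys)

  vs-distinct : Distinct vs
  vs-distinct with ws-split
  ... | ws₁-distinct , (_ ∷ ws₂-distinct) , ws₁-apart =
    Distinct-++⁺ ws₁ ws₁-distinct
      (Distinct-++⁺ ys ys-distinct ws₂-distinct (λ y∈ → ys-apart-ws y∈ ∘ ∈-++⁺ʳ ws₁ ∘ there))
      (λ w∈ → [ (λ w∈ys → ys-apart-ws w∈ys (∈-++⁺ˡ w∈)) , ws₁-apart w∈ ∘ there ]′ ∘ ∈-++⁻ ys)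
    where
      ys-apart-ws : ∀ {y} → y ∈ ys → y ∉ ws₁ ++ u ∷ ws₂
      ys-apart-ws = proj₂ ∘ clause-fresh ∘ inj₂

  length-vs : length vs ≡ length resolvent
  length-vs = begin
    length (ws₁ ++ ys ++ ws₂)              ≡⟨ length-++ ws₁ ⟩
    length ws₁ + length (ys ++ ws₂)        ≡⟨ cong (length ws₁ +_) (length-++ ys) ⟩
    length ws₁ + (length ys + length ws₂)  ≡⟨ cong₂ _+_ length₁ (cong₂ _+_ length₃ length₂) ⟩
    length xs + (length Bs₁ + length zs)   ≡⟨ cong (length xs +_) (sym (length-++ Bs₁)) ⟩
    length xs + length (Bs₁ ++ zs)         ≡⟨ sym (length-++ xs) ⟩
    length (xs ++ Bs₁ ++ zs)               ∎
    where open ≡-Reasoning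

  realizeGoal-resolvent : realizeGoal resolvent vs ≡ realizeGoal xs ws₁ ++ realizeGoal Bs₁ ys ++ realizeGoal zs ws₂
  realizeGoal-resolvent =
    trans (realizeGoal-++ xs (Bs₁ ++ zs) ws₁ (ys ++ ws₂) length₁)
          (cong (realizeGoal xs ws₁ ++_) (realizeGoal-++ Bs₁ zs ys ws₂ length₃))

  resolvent-realized : (γ : Subst Fn) (γ′ : Subst (Fn ⊎ ℕ)) (g : ℕ → ℕ)
    → (∀ {x} → x ∈ varsG resolvent → γ′ x ≡ liftT (γ x))
    → (∀ {v} → v ∈ vs → γ′ v ≡ var (g v))
    → (∀ {a b} → a ∈ vs → b ∈ vs → g a ≡ g b → a ≡ b)
    → (∀ {v x} → v ∈ vs → x ∈ varsG resolvent → g v ∉ varsT (γ x))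
    → substG γ′ (realizeGoal xs ws₁ ++ realizeGoal Bs₁ ys ++ realizeGoal zs ws₂) ≡ realizeGoal (substG γ resolvent) (map g vs)
      × Fresh (substG γ resolvent) (map g vs)
  resolvent-realized γ γ′ g γ′-lifted γ′-renames g-injective g-apart =
    trans (cong (substG γ′) (sym realizeGoal-resolvent))
          (substG-realizeGoal γ′ γ g resolvent vs (λ _ → γ′-lifted) (λ _ → γ′-renames)) ,
    fresh (trans (length-map g vs) (trans length-vs (sym (length-map (substA γ) resolvent))))
          (Distinct-map g vs-distinct g-injective)
          apart
    where
      apart : ∀ {w} → w ∈ map g vs → w ∉ varsG (substG γ resolvent)
      apart w∈ w∈′ with ∈-map⁻ g w∈ | ∈-varsG-substG⁻ γ resolvent w∈′
      ... | v , v∈ , refl | x , x∈ , gv∈ = g-apart v∈ x∈ gv∈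

  module Backward (γ′ : Subst (Fn ⊎ ℕ)) (mgu′ : MGU γ′ (liftA C₁ ⟦ fκ ⟧) (liftA A ⟦ var u ⟧)) where

    γ₁ : Subst Fn
    γ₁ = lowerT ∘ γ′

    γ₁-unifies : Unifier γ₁ (atom P ts) (atom Q ss)
    γ₁-unifies with ⟦⟧-unifier⁻ γ′ (liftTs ts) (liftTs ss) fκ (var u) (proj₁ mgu′)
    ... | P≡Q , args≡ , _ =
      cong₂ atom P≡Q (trans (sym (lowerTs-substTs-liftTs γ′ ts)) (trans (cong lowerTs args≡) (lowerTs-substTs-liftTs γ′ ss)))

    σ₀ : Subst (Fn ⊎ ℕ)
    σ₀ = extendAt (liftSubst (pinned γ₁)) u fκ

    σ₀-vs : ∀ {v} → v ∈ vs → σ₀ v ≡ var v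
    σ₀-vs v∈ = trans (extendAt-≢ (liftSubst (pinned γ₁)) u fκ (λ { refl → u∉vs v∈ })) (cong liftT (pinned-vs γ₁ v∈))

    σ₀-W : ∀ {x} → x ∈ W → σ₀ x ≡ liftT (pinned γ₁ x)
    σ₀-W x∈ = extendAt-≢ (liftSubst (pinned γ₁)) u fκ (λ { refl → u∉W x∈ })

    σ₀-apart : ∀ {v x} → v ∈ vs → x ∈ W → v ∉ varsT (σ₀ x)
    σ₀-apart {v} {x} v∈ x∈ =
      pinned-apart γ₁ v∈ x∈ ∘ subst (v ∈_) (varsT-liftT (pinned γ₁ x)) ∘ subst (λ t → v ∈ varsT t) (σ₀-W x∈)

    σ₀-unifies : Unifier σ₀ (liftA C₁ ⟦ fκ ⟧) (liftA A ⟦ var u ⟧)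
    σ₀-unifies = unifier-extendAt (liftSubst (pinned γ₁)) (liftTs ts) (liftTs ss) fκ u
      (unifier-liftA (pinned γ₁) C₁ A (pinned-unifies γ₁ γ₁-unifies)) u∉liftA-head u∉liftA-atom u∉ys

    δ₀-spec : ∃ λ δ₀ → ∀ z → σ₀ z ≡ substT δ₀ (γ′ z)
    δ₀-spec = proj₂ mgu′ σ₀ σ₀-unifies

    open FixedByFactor γ′ (proj₁ δ₀-spec) σ₀ (proj₂ δ₀-spec)

    γ′-lifted : ∀ {x} → x ∈ W → γ′ x ≡ liftT (γ₁ x)
    γ′-lifted {x} x∈ =
      substT≡liftT⇒lifted (proj₁ δ₀-spec) (γ′ x) (pinned γ₁ x) (trans (sym (proj₂ δ₀-spec x)) (σ₀-W x∈))

    γ : Subst Fn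
    γ = localise γ₁ W

    γ-mgu : MGU γ (atom P ts) (atom Q ss)
    γ-mgu = mgu-localise γ₁ (atom P ts) (atom Q ss) W W-head W-atom γ₁-unifies general
      where
        general : ∀ σ → Unifier σ (atom P ts) (atom Q ss) → ∃ λ δ → ∀ {x} → x ∈ W → σ x ≡ substT δ (γ₁ x)
        general σ σ-unifies = lowerT ∘ δ′ , factor′
          where
            σ′ : Subst (Fn ⊎ ℕ)
            σ′ = extendAt (liftSubst σ) u fκ
            δ′-spec : ∃ λ δ′ → ∀ z → σ′ z ≡ substT δ′ (γ′ z)
            δ′-spec = proj₂ mgu′ σ′ (unifier-extendAt (liftSubst σ) (liftTs ts) (liftTs ss) fκ u
                        (unifier-liftA σ (atom P ts) (atom Q ss) σ-unifies)
                        u∉liftA-head u∉liftA-atom u∉ys)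
            δ′ : Subst (Fn ⊎ ℕ)
            δ′ = proj₁ δ′-spec
            factor′ : ∀ {x} → x ∈ W → σ x ≡ substT (lowerT ∘ δ′) (γ₁ x)
            factor′ {x} x∈ = begin
              σ x                                     ≡⟨ sym (lowerT-liftT (σ x)) ⟩
              lowerT (liftT (σ x))                    ≡⟨ cong lowerT (sym (extendAt-≢ (liftSubst σ) u fκ (λ { refl → u∉W x∈ }))) ⟩
              lowerT (σ′ x)                           ≡⟨ cong lowerT (proj₂ δ′-spec x) ⟩
              lowerT (substT δ′ (γ′ x))               ≡⟨ cong (lowerT ∘ substT δ′) (γ′-lifted x∈) ⟩
              lowerT (substT δ′ (liftT (γ₁ x)))       ≡⟨ lowerT-substT-liftT δ′ (γ₁ x) ⟩
              substT (lowerT ∘ δ′) (γ₁ x)             ∎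
              where open ≡-Reasoning

    realized : substG γ′ (realizeGoal xs ws₁ ++ realizeGoal Bs₁ ys ++ realizeGoal zs ws₂)
                 ≡ realizeGoal (substG γ resolvent) (map (varOf ∘ γ′) vs)
               × Fresh (substG γ resolvent) (map (varOf ∘ γ′) vs)
    realized = resolvent-realized γ γ′ (varOf ∘ γ′)
      (λ x∈ → trans (γ′-lifted (W-resolvent x∈)) (cong liftT (sym (localise-∈ γ₁ W (W-resolvent x∈)))))
      (λ v∈ → proj₁ (fixed-var (σ₀-vs v∈)))
      (λ a∈ b∈ → fixed-injective (σ₀-vs a∈) (σ₀-vs b∈))
      (λ {v} {x} v∈ x∈ gv∈ → fixed-apart (σ₀-vs v∈) (σ₀-apart v∈ (W-resolvent x∈))
           (subst (λ t → varOf (γ′ v) ∈ varsT t) (sym (γ′-lifted (W-resolvent x∈)))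
             (subst (varOf (γ′ v) ∈_) (sym (varsT-liftT (γ₁ x)))
               (subst (λ t → varOf (γ′ v) ∈ varsT t) (localise-∈ γ₁ W (W-resolvent x∈)) gv∈))))

  module Forward (γ : Subst Fn) (mgu : MGU γ C₁ A) where

    γ′ : Subst (Fn ⊎ ℕ)
    γ′ = extendAt (liftSubst γ) u fκ

    γ′-mgu : MGU γ′ (liftA (atom P ts) ⟦ fκ ⟧) (liftA (atom Q ss) ⟦ var u ⟧)
    γ′-mgu = mgu-extendAt (liftSubst γ) (liftTs ts) (liftTs ss) fκ u (mgu-liftA γ (atom P ts) (atom Q ss) mgu)
               u∉liftA-head u∉liftA-atom u∉ys

    δ₀-spec : ∃ λ δ₀ → ∀ z → pinned γ z ≡ substT δ₀ (γ z)
    δ₀-spec = proj₂ mgu (pinned γ) (pinned-unifies γ (proj₁ mgu))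

    open FixedByFactor γ (proj₁ δ₀-spec) (pinned γ) (proj₂ δ₀-spec)

    realized : substG γ′ (realizeGoal xs ws₁ ++ realizeGoal Bs₁ ys ++ realizeGoal zs ws₂)
                 ≡ realizeGoal (substG γ resolvent) (map (varOf ∘ γ) vs)
               × Fresh (substG γ resolvent) (map (varOf ∘ γ) vs)
    realized = resolvent-realized γ γ′ (varOf ∘ γ)
      (λ x∈ → extendAt-≢ (liftSubst γ) u fκ (λ { refl → u∉W (W-resolvent x∈) }))
      (λ v∈ → trans (extendAt-≢ (liftSubst γ) u fκ (λ { refl → u∉vs v∈ }))
                    (cong liftT (proj₁ (fixed-var (pinned-vs γ v∈)))))
      (λ a∈ b∈ → fixed-injective (pinned-vs γ a∈) (pinned-vs γ b∈))
      (λ v∈ x∈ → fixed-apart (pinned-vs γ v∈) (pinned-apart γ v∈ (W-resolvent x∈)))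

-- Simulation in both directions

module _ {Fn Pr : Set} {Φ : Program Fn Pr} where

  realize-step⁻ : {H₀ H : Goal (Fn ⊎ ℕ) Pr} → F Φ ⊢ H₀ ⇝ H → (G : Goal Fn Pr) (ws : List ℕ)
    → H₀ ≡ realizeGoal G ws → Fresh G ws
    → ∃ λ G′ → ∃ λ ws′ → Φ ⊢ G ⇝ G′ × H ≡ realizeGoal G′ ws′ × Fresh G′ ws′
  realize-step⁻ (step {xs′} c′ c′∈ ρ ρ-inj c′-fresh γ′ mgu′) G ws e (fresh l ws-distinct ws-fresh)
    with ∈-realizeFrom⁻ 0 Φ c′∈ | realizeGoal-split G ws xs′ l (sym e)
  ... | κ , atom P ts ⇐ Bs , c∈ , refl
      | record { xs = xs ; A = atom Q ss ; zs = zs ; ws₁ = ws₁ ; u = u ; ws₂ = ws₂ ; G≡ = refl ; ws≡ = refl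
               ; length₁ = length₁ ; length₂ = length₂ ; xs′≡ = refl ; A′≡ = refl ; zs′≡ = refl } =
    substG γ resolvent , map (varOf ∘ γ′) vs ,
    step c c∈ ρ ρ-inj (λ x x∈ → proj₁ (clause-fresh (inj₁ x∈))) γ γ-mgu ,
    trans (cong (λ b → substG γ′ (realizeGoal xs ws₁ ++ b ++ realizeGoal zs ws₂)) (cong body renamed)) (proj₁ realized) ,
    proj₂ realized
    where
      c : Clause Fn Pr
      c = atom P ts ⇐ Bs
      ys : List ℕ
      ys = map ρ (witnessVars c)
      renamed : renameC ρ (realizeClause κ c) ≡ realizedClause κ (substA (rename ρ) (atom P ts)) (substG (rename ρ) Bs) ys
      renamed = renameC-realizeClause κ (atom P ts) Bs ρ
      length₃ : length ys ≡ length (substG (rename ρ) Bs)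
      length₃ = trans (length-map ρ (witnessVars c)) (trans (length-witnessVars (atom P ts) Bs) (sym (length-map _ Bs)))
      goal-vars⁺ : ∀ {x} → x ∈ varsG (xs ++ atom Q ss ∷ zs) ⊎ x ∈ ws₁ ++ u ∷ ws₂
                 → x ∈ varsG (realizeGoal xs ws₁ ++ (liftA (atom Q ss) ⟦ var u ⟧) ∷ realizeGoal zs ws₂)
      goal-vars⁺ {x} = subst (λ H → x ∈ varsG H) (realizeGoal-++ xs (atom Q ss ∷ zs) ws₁ (u ∷ ws₂) length₁)
                       ∘ ∈-varsG-realizeGoal⁺ (xs ++ atom Q ss ∷ zs) (ws₁ ++ u ∷ ws₂) l
      clause-vars⁺ : ∀ {x} → x ∈ varsC (renameC ρ c) ⊎ x ∈ ys → x ∈ varsC (renameC ρ (realizeClause κ c))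
      clause-vars⁺ {x} = subst (λ c″ → x ∈ varsC c″) (sym renamed)
                         ∘ ∈-varsC-realizedClause⁺ κ (substA (rename ρ) (atom P ts)) (substG (rename ρ) Bs) ys length₃
      clause-fresh : ∀ {x} → x ∈ varsC (renameC ρ c) ⊎ x ∈ ys → x ∉ varsG (xs ++ atom Q ss ∷ zs) × x ∉ ws₁ ++ u ∷ ws₂
      clause-fresh x∈ = c′-fresh _ (clause-vars⁺ x∈) ∘ goal-vars⁺ ∘ inj₁ ,
                        c′-fresh _ (clause-vars⁺ x∈) ∘ goal-vars⁺ ∘ inj₂
      ys-fresh : ∀ {y} → y ∈ ys → y ∉ varsC (renameC ρ c)
      ys-fresh y∈ y∈c with ∈-map⁻ ρ y∈ | ∈-varsC-rename⁻ ρ c y∈c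
      ... | k , k∈ , refl | j , j∈ , ρk≡ρj = <⇒≢ (varsC<witnessVars c j∈ k∈) (sym (ρ-inj ρk≡ρj))
      open StepLayout κ P Q (substTs (rename ρ) ts) ss xs zs (substG (rename ρ) Bs) ws₁ ws₂ ys u length₁ length₂ length₃
                      ws-distinct (Distinct-map ρ (witnessVars-distinct c) (λ _ _ → ρ-inj)) ws-fresh clause-fresh ys-fresh
      open Backward γ′ (subst (λ h → MGU γ′ h (liftA (atom Q ss) ⟦ var u ⟧)) (cong head renamed) mgu′)

  realized⇒derivable : {H : Goal (Fn ⊎ ℕ) Pr} → F Φ ⊢ H ⇝* [] → (G : Goal Fn Pr) (ws : List ℕ)
    → H ≡ realizeGoal G ws → Fresh G ws → Φ ⊢ G ⇝* []
  realized⇒derivable done G ws e fr =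
    subst (λ G → Φ ⊢ G ⇝* []) (sym (realizeGoal≡[] G ws (Fresh.length≡ fr) (sym e))) done
  realized⇒derivable (more s D) G ws e fr =
    let G′ , ws′ , s′ , e′ , fr′ = realize-step⁻ s G ws e fr in more s′ (realized⇒derivable D G′ ws′ e′ fr′)

module _ {Fn Pr : Set} {Φ : Program Fn Pr} where

  realize-step⁺ : {G G′ : Goal Fn Pr} (s : Φ ⊢ G ⇝ G′) (ws : List ℕ) → Fresh G ws
    → (∀ {x} → x ∈ renamedClauseVars s → x ∉ ws)
    → ∃ λ ws′ → F Φ ⊢ realizeGoal G ws ⇝ realizeGoal G′ ws′ × Fresh G′ ws′
  realize-step⁺ (step {xs} {atom Q ss} {zs} (atom P ts ⇐ Bs) c∈ ρ ρ-inj c-fresh γ mgu) ws (fresh l ws-distinct ws-fresh) avoids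
    with length-++-∷⁻ xs ws l
  ... | ws₁ , u , ws₂ , refl , length₁ , length₂ =
    map (varOf ∘ γ) vs ,
    subst₂ (F Φ ⊢_⇝_) (sym realized-goal)
      (trans (cong (λ b → substG γ′ (realizeGoal xs ws₁ ++ b ++ realizeGoal zs ws₂)) (cong body renamed)) (proj₁ realized))
      (step (realizeClause κ c) c̃∈ ρ′ (patchAbove-injective (varsC c) ρ M ρ-inj ρ<M) realized-fresh γ′
        (subst (λ h → MGU γ′ h (liftA (atom Q ss) ⟦ var u ⟧)) (sym (cong head renamed)) γ′-mgu)) ,
    proj₂ realized
    where
      c : Clause Fn Pr
      c = atom P ts ⇐ Bs
      κ : ℕ
      κ = proj₁ (∈-realizeFrom⁺ 0 Φ c∈)
      c̃∈ : realizeClause κ c ∈ F Φ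
      c̃∈ = proj₂ (∈-realizeFrom⁺ 0 Φ c∈)
      G : Goal Fn Pr
      G = xs ++ atom Q ss ∷ zs
      M : ℕ
      M = bound (map ρ (varsC c) ++ varsG G ++ ws₁ ++ u ∷ ws₂)
      ρ<M : ∀ {x} → x ∈ varsC c → ρ x < M
      ρ<M x∈ = ∈⇒<bound _ (∈-++⁺ˡ (∈-map⁺ ρ x∈))
      G<M : ∀ {x} → x ∈ varsG G → x < M
      G<M x∈ = ∈⇒<bound _ (∈-++⁺ʳ (map ρ (varsC c)) (∈-++⁺ˡ x∈))
      ws<M : ∀ {x} → x ∈ ws₁ ++ u ∷ ws₂ → x < M
      ws<M x∈ = ∈⇒<bound _ (∈-++⁺ʳ (map ρ (varsC c)) (∈-++⁺ʳ (varsG G) x∈))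
      ρ′ : ℕ → ℕ
      ρ′ = patchAbove (varsC c) ρ M
      ys : List ℕ
      ys = map (M +_) (witnessVars c)
      M≤ys : ∀ {y} → y ∈ ys → M ≤ y
      M≤ys y∈ with ∈-map⁻ (M +_) y∈
      ... | k , _ , refl = m≤m+n M k
      Bs₁ : Goal Fn Pr
      Bs₁ = substG (rename ρ) Bs
      renamed : renameC ρ′ (realizeClause κ c) ≡ realizedClause κ (substA (rename ρ) (atom P ts)) Bs₁ ys
      renamed = renameC-realizeClause-above κ (atom P ts) Bs ρ M ρ<M
      length₃ : length ys ≡ length Bs₁
      length₃ = trans (length-map (M +_) (witnessVars c)) (trans (length-witnessVars (atom P ts) Bs) (sym (length-map _ Bs)))
      clause-fresh : ∀ {x} → x ∈ varsC (renameC ρ c) ⊎ x ∈ ys → x ∉ varsG G × x ∉ ws₁ ++ u ∷ ws₂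
      clause-fresh (inj₁ x∈) = c-fresh _ x∈ , avoids x∈
      clause-fresh (inj₂ y∈) = (λ y∈G → <-irrefl refl (<-≤-trans (G<M y∈G) (M≤ys y∈))) ,
                               (λ y∈ws → <-irrefl refl (<-≤-trans (ws<M y∈ws) (M≤ys y∈)))
      ys-fresh : ∀ {y} → y ∈ ys → y ∉ varsC (renameC ρ c)
      ys-fresh y∈ y∈c with ∈-varsC-rename⁻ ρ c y∈c
      ... | j , j∈ , refl = <-irrefl refl (<-≤-trans (ρ<M j∈) (M≤ys y∈))
      open StepLayout κ P Q (substTs (rename ρ) ts) ss xs zs Bs₁ ws₁ ws₂ ys u length₁ length₂ length₃
                      ws-distinct (Distinct-map (M +_) (witnessVars-distinct c) (λ _ _ → +-cancelˡ-≡ M _ _))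
                      ws-fresh clause-fresh ys-fresh
      open Forward γ mgu
      realized-goal : realizeGoal G (ws₁ ++ u ∷ ws₂)
                      ≡ realizeGoal xs ws₁ ++ (liftA (atom Q ss) ⟦ var u ⟧) ∷ realizeGoal zs ws₂
      realized-goal = realizeGoal-++ xs (atom Q ss ∷ zs) ws₁ (u ∷ ws₂) length₁
      realized-fresh : ∀ x → x ∈ varsC (renameC ρ′ (realizeClause κ c))
                     → x ∉ varsG (realizeGoal xs ws₁ ++ (liftA (atom Q ss) ⟦ var u ⟧) ∷ realizeGoal zs ws₂)
      realized-fresh x x∈ x∈′ =
        [ proj₁ x-fresh , proj₂ x-fresh ]′
          (∈-varsG-realizeGoal⁻ G (ws₁ ++ u ∷ ws₂) (subst (λ H → x ∈ varsG H) (sym realized-goal) x∈′))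
        where
          x-fresh : x ∉ varsG G × x ∉ ws₁ ++ u ∷ ws₂
          x-fresh = clause-fresh (∈-varsC-realizedClause⁻ κ (substA (rename ρ) (atom P ts)) Bs₁ ys
                                    (subst (λ c′ → x ∈ varsC c′) renamed x∈))

module _ {Fn Pr : Set} {Φ : Program Fn Pr} where

  open Inverse using (to)

  ⇝-rename-apart : {G G′ : Goal Fn Pr} (s : Φ ⊢ G ⇝ G′) (π : ℕ ↔ ℕ) (ws : List ℕ)
    → (∀ {w} → w ∈ ws → w ∉ varsG (substG (rename (to π)) G))
    → ∃ λ π₁ → ∃ λ G₁ → ∃ λ G₁′ → Σ (Φ ⊢ G₁ ⇝ G₁′) λ s′ → G₁ ≡ substG (rename (to π)) G
        × G₁′ ≡ substG (rename (to π₁)) G′ × (∀ {x} → x ∈ renamedClauseVars s′ → x ∉ ws)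
  ⇝-rename-apart {G} s π ws ws-fresh = π₁ , source , target , step′ , trans source≡ same-on-G , target≡ , avoids
    where
      K : ℕ
      K = bound (ws ++ map (to π) (varsG G ++ renamedClauseVars s))
      below-K : ∀ {x} → x ∈ varsG G ++ renamedClauseVars s → to π x < K
      below-K x∈ = ∈⇒<bound (ws ++ _) (∈-++⁺ʳ ws (∈-map⁺ (to π) x∈))
      open SwapAbove ws K (∈⇒<bound (ws ++ _) ∘ ∈-++⁺ˡ)
      π₁ : ℕ ↔ ℕ
      π₁ = swap↔ ↔-∘ π
      open Renaming.RenamedStep (Renaming.⇝-rename π₁ s)
      same-on-G : substG (rename (to π₁)) G ≡ substG (rename (to π)) G
      same-on-G = substG-cong _ _ G (λ x x∈ → cong var (swap-below
        (λ πx∈ → ws-fresh πx∈ (∈-varsG-substG⁺ (rename (to π)) G x∈ (here refl))) (below-K (∈-++⁺ˡ x∈))))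
      avoids : ∀ {x} → x ∈ renamedClauseVars step′ → x ∉ ws
      avoids x∈ with clause-vars x∈
      ... | y , y∈ , refl = swap-∉ (below-K (∈-++⁺ʳ (varsG G) y∈))

  derivable⇒realized : {G : Goal Fn Pr} → Φ ⊢ G ⇝* [] → (π : ℕ ↔ ℕ) (ws : List ℕ)
    → Fresh (substG (rename (to π)) G) ws → F Φ ⊢ realizeGoal (substG (rename (to π)) G) ws ⇝* []
  derivable⇒realized done       π ws fr = done
  derivable⇒realized (more s D) π ws fr with ⇝-rename-apart s π ws (Fresh.apart fr)
  ... | π₁ , G₁ , G₁′ , s′ , refl , refl , avoids with realize-step⁺ s′ ws fr avoids
  ...   | ws′ , F-step , fr′ = more F-step (derivable⇒realized D π₁ ws′ fr′)

∈-toList⇒lookup : {A : Set} {n : ℕ} (xs : Vec A n) {x : A} → x ∈ toList xs → ∃ λ i → x ≡ lookup xs i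
∈-toList⇒lookup xs x∈ = VecAny.index (∈-toList⁻ x∈) , lookup-index (∈-toList⁻ x∈)

Distinct-toList : {n : ℕ} (ys : Vec ℕ n) → (∀ i j → lookup ys i ≡ lookup ys j → i ≡ j) → Distinct (toList ys)
Distinct-toList []       inj = []
Distinct-toList (y ∷ ys) inj =
  (λ y∈ → let j , y≡ = ∈-toList⇒lookup ys y∈ in Fin.0≢1+n (inj zero (suc j) y≡))
  ∷ Distinct-toList ys (λ i j e → Fin.suc-injective (inj (suc i) (suc j) e))

module _ {Fn Pr : Set} where

  toList-zipWith-realized : {n : ℕ} (As : Vec (Atom Fn Pr) n) (ys : Vec ℕ n)
    → toList (zipWith (λ A y → liftA A ⟦ var y ⟧) As ys) ≡ realizeGoal (toList As) (toList ys)
  toList-zipWith-realized []       []       = refl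
  toList-zipWith-realized (A ∷ As) (y ∷ ys) = cong (_ ∷_) (toList-zipWith-realized As ys)

  fresh-toList : {n : ℕ} (As : Vec (Atom Fn Pr) n) (ys : Vec ℕ n)
    → (∀ i j → lookup ys i ≡ lookup ys j → i ≡ j) → (∀ i j → lookup ys i ∉ varsA (lookup As j))
    → Fresh (toList As) (toList ys)
  fresh-toList As ys ys-injective ys-fresh =
    fresh (trans (length-toList ys) (sym (length-toList As))) (Distinct-toList ys ys-injective) apart
    where
      apart : ∀ {w} → w ∈ toList ys → w ∉ varsG (toList As)
      apart w∈ys w∈As with ∈-toList⇒lookup ys w∈ys | find (∈-concatMap⁻ varsA w∈As)
      ... | i , refl | A , A∈ , w∈A with ∈-toList⇒lookup As A∈
      ...   | j , refl = ys-fresh i j w∈A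

lemma3 : {Fn Pr : Set} (Φ : Program Fn Pr) (n : ℕ)
    (As : Vec (Atom Fn Pr) n) (ys : Vec ℕ n)
    → (∀ i j → lookup ys i ≡ lookup ys j → i ≡ j)
    → (∀ i j → lookup ys i ∉ varsA (lookup As j))
    → (Φ ⊢ toList As ⇝* [])
      ⇔ (F Φ ⊢ toList (zipWith (λ A y → liftA A ⟦ var y ⟧) As ys) ⇝* [])
lemma3 Φ n As ys ys-injective ys-fresh = mk⇔ completeness soundness
  where
    realized≡ : toList (zipWith (λ A y → liftA A ⟦ var y ⟧) As ys) ≡ realizeGoal (toList As) (toList ys)
    realized≡ = toList-zipWith-realized As ys
    initial : Fresh (toList As) (toList ys)
    initial = fresh-toList As ys ys-injective ys-fresh
    completeness : Φ ⊢ toList As ⇝* [] → F Φ ⊢ toList (zipWith (λ A y → liftA A ⟦ var y ⟧) As ys) ⇝* []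
    completeness D =
      subst (λ H → F Φ ⊢ H ⇝* []) (trans (cong (λ G → realizeGoal G (toList ys)) unrenamed) (sym realized≡))
        (derivable⇒realized D (↔-id ℕ) (toList ys) (subst (λ G → Fresh G (toList ys)) (sym unrenamed) initial))
      where
        unrenamed : substG var (toList As) ≡ toList As
        unrenamed = substG-identity (toList As)
    soundness : F Φ ⊢ toList (zipWith (λ A y → liftA A ⟦ var y ⟧) As ys) ⇝* [] → Φ ⊢ toList As ⇝* []
    soundness D = realized⇒derivable D (toList As) (toList ys) realized≡ initial
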